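{- Let $x$ and $y$ be integer sequences of length $k$ with identical second-order cyclic statistics, i.e. $S_{i_1,i_2}(x)=S_{i_1,i_2}(y)$ for all $i_1,i_2\in[k]$. Then for each $\alpha\in[k]$, either (1) $\hat{x}_j\neq 0$ and $\hat{y}_j\neq 0$ for all $j\in G_\alpha$, or (2) $\hat{x}_j=\hat{y}_j=0$ for all $j\in G_\alpha$.
   Context: $[k]=\{1,\ldots,k\}$; indices are interpreted mod $k$. Cyclic statistic: $S_{i_1,\ldots,i_m}(x)=\sum_{j=1}^{k} x_{i_1+j}\cdots x_{i_m+j}$ (indices mod $k$). Fourier transform: $\hat{x}_j=\sum_{\ell=0}^{k-1}x_\ell\, e^{2\pi i j\ell/k}$. For $\alpha\in[k]$, $G_\alpha=\{j\in[k]:\gcd(j,k)=\alpha\}$. -}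

module Defs where

open import Level using (Level; _⊔_)
open import Data.Nat as ℕ using (ℕ; zero; suc; NonZero; _%_)
open import Data.Nat.DivMod using (m%n<n)
open import Data.Nat.GCD using (gcd)
open import Data.Fin using (Fin; fromℕ<)
open import Data.Integer as ℤ using (ℤ; +_; -[1+_])
open import Data.Product using (_×_)
open import Data.Sum using (_⊎_)
open import Relation.Nullary using (¬_)
open import Relation.Binary.PropositionalEquality using (_≡_)
open import Algebra.Bundles using (CommutativeRing)

sumℤ : ℕ → (ℕ → ℤ) → ℤ
sumℤ zero    f = + 0
sumℤ (suc n) f = sumℤ n f ℤ.+ f n

at : (k : ℕ) .{{_ : NonZero k}} → (Fin k → ℤ) → ℕ → ℤ
at k x n = x (fromℕ< (m%n<n n k))

-- Second-order cyclic statistic S_{i₁,i₂}(x) = Σ_{j=1}^{k} x_{i₁+j} x_{i₂+j}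
-- (indices mod k).  We sum over j' = 0..k-1 with j = j'+1.
S₂ : (k : ℕ) .{{_ : NonZero k}} → (Fin k → ℤ) → ℕ → ℕ → ℤ
S₂ k x i₁ i₂ = sumℤ k (λ j → at k x (i₁ ℕ.+ suc j) ℤ.* at k x (i₂ ℕ.+ suc j))

InG : (k α j : ℕ) → Set
InG k α j = (1 ℕ.≤ j) × (j ℕ.≤ k) × (gcd j k ≡ α)

module _ {c ℓ : Level} (R : CommutativeRing c ℓ) where
  open CommutativeRing R

  ofℕ : ℕ → Carrier
  ofℕ zero    = 0#
  ofℕ (suc n) = 1# + ofℕ n

  ofℤ : ℤ → Carrier
  ofℤ (+ n)     = ofℕ n
  ofℤ -[1+ n ]  = - ofℕ (suc n)

  pow : Carrier → ℕ → Carrier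
  pow a zero    = 1#
  pow a (suc n) = a * pow a n

  sumR : ℕ → (ℕ → Carrier) → Carrier
  sumR zero    f = 0#
  sumR (suc n) f = sumR n f + f n

  record IsChar0Domain : Set (c ⊔ ℓ) where
    field
      nontrivial : ¬ (1# ≈ 0#)
      noZeroDivisors : ∀ a b → a * b ≈ 0# → (a ≈ 0#) ⊎ (b ≈ 0#)
      char0 : ∀ n → ¬ (ofℕ (suc n) ≈ 0#)

  record IsPrimitiveRoot (k : ℕ) (ω : Carrier) : Set ℓ where
    field
      root : pow ω k ≈ 1#
      minimal : ∀ m → 1 ℕ.≤ m → m ℕ.< k → ¬ (pow ω m ≈ 1#)

  fourier : (k : ℕ) .{{_ : NonZero k}} → Carrier → (Fin k → ℤ) → ℕ → Carrier
  fourier k ω x j = sumR k (λ l → ofℤ (at k x l) * pow ω (j ℕ.* l))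

module Submission where

-- The cyclic autocorrelation S₂ determines x̂ⱼ x̂ₖ₋ⱼ = Pₓ(ζ) Pₓ(ζ⁻¹), where Pₓ = ∑ xₗ Xˡ and ζ = ωʲ, so this
-- product is the same for x and y. Write k = m α; for j = a α in G_α, ωʲ = ηᵃ with η = ωᵅ a primitive m-th root
-- of unity and a coprime to m. As Pₓ has integer coefficients, it vanishes at one primitive m-th root of unity iff
-- it vanishes at all of them, iff Φₘ ∣ Pₓ, which is decidable. This settles the dichotomy for x, and the product
-- identity at j = α carries it over to y.
-- That primitive roots are conjugate is the irreducibility of Φₘ: if f is the minimal integer polynomial of ξ and
-- p ∤ m is prime, then f(ξᵖ) = 0. Otherwise the cofactor s in (Xᵐ - 1) ∼ s f has s(ζ) s(ζᵖ) = 0 at all m-th roots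
-- of unity ζ, and Frobenius, w(x)ᵖ ≡ w(xᵖ) (mod p), shows that the coefficients of such an s are divisible by every
-- power of p, so s = 0. Over a characteristic-0 domain, minimal polynomials and these case distinctions are only
-- available under double negation; the decidable test Φₘ ∣ Pₓ lets the final statement escape it.

open import Defs
open import Level using (Level; _⊔_)
open import Data.Nat as ℕ using (ℕ; zero; suc; NonZero; _≤_; _<_; z≤n; s≤s)
import Data.Nat.Properties as ℕP
open import Data.Nat.DivMod using (_%_; _/_; [m+kn]%n≡m%n; [m+n]%n≡m%n; %-distribˡ-*; m%n%n≡m%n; m≡m%n+[m/n]*n; m%n<n; m*[n/m]≡n)
open import Data.Nat.Divisibility using (_∣_; _∣?_; divides; ∣-trans; ∣m+n∣m⇒∣n; ∣⇒≤; m∣m*n; n∣m*n; m%n≡0⇒n∣m)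
open import Data.Nat.Coprimality as Coprimality using (Coprime; coprime?; coprime-+; coprime-divisor; coprime-Bézout; gcd≡1⇒coprime; 1-coprimeTo)
open import Data.Nat.GCD using (gcd; gcd[m,n]∣m; gcd[m,n]∣n; c*gcd[m,n]≡gcd[cm,cn]; module Bézout)
open import Data.Nat.Combinatorics using (_C_; nCn≡1; nC1≡n; nCk+nC[k+1]≡[n+1]C[k+1])
open import Data.Nat.Primality using (Prime; euclidsLemma; ¬prime[0]; prime⇒nonZero; prime⇒nonTrivial)
open import Data.Nat.Primality.Factorisation using (PrimeFactorisation; factorise)
open import Data.Nat.ListAction using (product)
open import Data.Nat.Solver using (module +-*-Solver)
open import Data.Fin using (Fin; toℕ)
open import Data.Fin.Properties using (fromℕ<-cong)
open import Data.Integer as ℤ using (ℤ; +_; -[1+_]; 0ℤ; 1ℤ; -1ℤ; _⊖_)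
import Data.Integer.Properties as ℤP
open import Data.Sign as Sign using (Sign)
open import Data.Empty using (⊥)
open import Function using (id)
open import Data.List using (List; []; _∷_; _++_; _∷ʳ_; length; map; replicate; foldr; take; drop; applyUpTo; initLast; _∷ʳ′_)
open import Data.List.Properties using (length-map; length-++; length-replicate; length-take; length-drop)
open import Data.List.Relation.Unary.All as All using (All; []; _∷_; all?)
open import Data.List.Relation.Unary.All.Properties using (++⁺; ++⁻ʳ)
open import Data.Product using (Σ; Σ-syntax; ∃-syntax; _×_; _,_; proj₁; proj₂)
open import Data.Sum using (_⊎_; inj₁; inj₂; [_,_]′)
import Data.Maybe as Maybe
open import Algebra.Bundles using (CommutativeRing; Ring)
open import Algebra.Solver.Ring.AlmostCommutativeRing using (fromCommutativeRing; _-Raw-AlmostCommutative⟶_)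
import Algebra.Solver.Ring as RingSolver
import Algebra.Definitions.RawMonoid as RawMonoidDefinitions
import Algebra.Properties.Semiring.Mult as SemiringMult
import Algebra.Properties.Semiring.Exp as SemiringExp
import Algebra.Properties.CommutativeSemiring.Exp as CommutativeSemiringExp
import Algebra.Properties.CommutativeSemiring.Binomial as CommutativeSemiringBinomial
import Algebra.Properties.Ring as RingProperties
import Algebra.Properties.RingWithoutOne as RingWithoutOneProperties
import Algebra.Properties.AbelianGroup as AbelianGroupProperties
import Algebra.Properties.CommutativeSemigroup as CommutativeSemigroupProperties
import Relation.Binary.Reasoning.Setoid as SetoidReasoning
open import Relation.Nullary using (¬_; Dec; yes; no; contradiction)
open import Relation.Nullary.Decidable using (dec⇒maybe; decidable-stable; ¬¬-excluded-middle)
open import Relation.Binary.PropositionalEquality as ≡ using (_≡_; _≢_)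

module NumberTheory where

  open import Data.Nat using (_+_; _*_; _∸_)
  open ≡ using (refl; cong; sym; trans)
  open ≡.≡-Reasoning

  [1+k]*[1+n]C[1+k]≡[1+n]*nCk : ∀ n k → suc k * (suc n C suc k) ≡ suc n * (n C k)
  [1+k]*[1+n]C[1+k]≡[1+n]*nCk zero    zero    = refl
  [1+k]*[1+n]C[1+k]≡[1+n]*nCk zero    (suc k) = ℕP.*-zeroʳ (suc (suc k))
  [1+k]*[1+n]C[1+k]≡[1+n]*nCk (suc n) zero    = trans (ℕP.*-identityˡ _) (trans (nC1≡n (suc (suc n))) (sym (ℕP.*-identityʳ _)))
  [1+k]*[1+n]C[1+k]≡[1+n]*nCk (suc n) (suc k) = begin
    suc (suc k) * (suc (suc n) C suc (suc k))           ≡⟨ cong (suc (suc k) *_) (sym (nCk+nC[k+1]≡[n+1]C[k+1] (suc n) (suc k))) ⟩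
    suc (suc k) * (A + B)                               ≡⟨ expand k A B ⟩
    A + (suc k * A + suc (suc k) * B)                   ≡⟨ ≡.cong₂ (λ x y → A + (x + y)) ([1+k]*[1+n]C[1+k]≡[1+n]*nCk n k)
                                                                                          ([1+k]*[1+n]C[1+k]≡[1+n]*nCk n (suc k)) ⟩
    A + (suc n * (n C k) + suc n * (n C suc k))         ≡⟨ cong (λ t → A + t) (sym (ℕP.*-distribˡ-+ (suc n) (n C k) (n C suc k))) ⟩
    A + suc n * (n C k + n C suc k)                     ≡⟨ cong (λ t → A + suc n * t) (nCk+nC[k+1]≡[n+1]C[k+1] n k) ⟩
    suc (suc n) * A                                     ∎
    where
    A = suc n C suc k
    B = suc n C suc (suc k)
    expand : ∀ k a b → suc (suc k) * (a + b) ≡ a + (suc k * a + suc (suc k) * b)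
    expand = solve 3 (λ k a b → (con 2 :+ k) :* (a :+ b) := a :+ ((con 1 :+ k) :* a :+ (con 2 :+ k) :* b)) refl
      where open +-*-Solver

  prime∣pC[1+k] : ∀ {p} → Prime (suc p) → ∀ {k} → k < p → suc p ∣ suc p C suc k
  prime∣pC[1+k] {p} p-prime {k} k<p with euclidsLemma (suc k) (suc p C suc k) p-prime
    (≡.subst (suc p ∣_) (sym ([1+k]*[1+n]C[1+k]≡[1+n]*nCk p k)) (m∣m*n (p C k)))
  ... | inj₁ p∣1+k = contradiction (∣⇒≤ p∣1+k) (ℕP.<⇒≱ (s≤s k<p))
  ... | inj₂ p∣C   = p∣C

  ∣p*c∣≤1+n⇒∣c∣≤n : ∀ {p n} c → 1 < p → c ≢ 0ℤ → ℤ.∣ + p ℤ.* c ∣ ≤ suc n → ℤ.∣ c ∣ ≤ n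
  ∣p*c∣≤1+n⇒∣c∣≤n {p} c 1<p c≢0 ∣pc∣≤1+n = ℕP.≤-pred (ℕP.<-≤-trans
    (ℕP.m<m*n ℤ.∣ c ∣ p {{ℕ.≢-nonZero (λ ∣c∣≡0 → c≢0 (ℤP.∣i∣≡0⇒i≡0 ∣c∣≡0))}} 1<p)
    (ℕP.≤-trans (ℕP.≤-reflexive (trans (ℕP.*-comm ℤ.∣ c ∣ p) (sym (ℤP.abs-* (+ p) c)))) ∣pc∣≤1+n))

  coprime-∣ : ∀ {d a m} → d ∣ a → Coprime a m → Coprime d m
  coprime-∣ d∣a a⊥m (e∣d , e∣m) = a⊥m (∣-trans e∣d d∣a , e∣m)

  coprime-* : ∀ {a b m} → Coprime a m → Coprime b m → Coprime (a * b) m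
  coprime-* a⊥m b⊥m (d∣ab , d∣m) =
    b⊥m (coprime-divisor (λ (e∣d , e∣a) → a⊥m (e∣a , ∣-trans e∣d d∣m)) d∣ab , d∣m)

  coprime-∸ : ∀ {a m} → a ≤ m → Coprime a m → Coprime (m ∸ a) m
  coprime-∸ a≤m a⊥m (d∣m∸a , d∣m) =
    a⊥m (∣m+n∣m⇒∣n (≡.subst (_ ∣_) (sym (ℕP.m∸n+n≡m a≤m)) d∣m) d∣m∸a , d∣m)

  gcd[aα,mα]≡α⇒coprime : ∀ {α a m} → .{{NonZero α}} → gcd (a * α) (m * α) ≡ α → Coprime a m
  gcd[aα,mα]≡α⇒coprime {α} {a} {m} gcd≡α = gcd≡1⇒coprime (ℕP.*-cancelˡ-≡ (gcd a m) 1 α (begin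
    α * gcd a m           ≡⟨ c*gcd[m,n]≡gcd[cm,cn] α a m ⟩
    gcd (α * a) (α * m)   ≡⟨ ≡.cong₂ gcd (ℕP.*-comm α a) (ℕP.*-comm α m) ⟩
    gcd (a * α) (m * α)   ≡⟨ gcd≡α ⟩
    α                     ≡⟨ sym (ℕP.*-identityʳ α) ⟩
    α * 1                 ∎))

  gcd≡α⇒coprime-quotient : ∀ {k α j} m .{{_ : NonZero α}} → k ≡ m * α → j ≤ k → gcd j k ≡ α →
                           ∃[ a ] j ≡ a * α × Coprime a m
  gcd≡α⇒coprime-quotient {k} {α} {j} m k≡mα j≤k gcd≡α with ≡.subst (_∣ j) gcd≡α (gcd[m,n]∣m j k)
  ... | divides a j≡aα = a , j≡aα , gcd[aα,mα]≡α⇒coprime (≡.subst₂ (λ j k → gcd j k ≡ α) j≡aα k≡mα gcd≡α)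

  -- e = m / gcd(i, m).
  non-coprime⇒proper-period : ∀ {i m} .{{_ : NonZero m}} → ¬ Coprime i m → ∃[ e ] 0 < e × e < m × m ∣ i * e
  non-coprime⇒proper-period {i} {m} ¬i⊥m with gcd[m,n]∣m i m | gcd[m,n]∣n i m
  ... | divides a i≡ag | divides e m≡eg = e , ℕP.n≢0⇒n>0 e≢0 , e<m , divides a (begin
    i * e        ≡⟨ cong (_* e) i≡ag ⟩
    a * g * e    ≡⟨ ℕP.*-assoc a g e ⟩
    a * (g * e)  ≡⟨ cong (a *_) (ℕP.*-comm g e) ⟩
    a * (e * g)  ≡⟨ cong (a *_) (sym m≡eg) ⟩
    a * m        ∎)
    where
    g = gcd i m
    m≢0 : m ≢ 0
    m≢0 = ℕ.≢-nonZero⁻¹ m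
    e≢0 : e ≢ 0
    e≢0 e≡0 = m≢0 (trans m≡eg (cong (_* g) e≡0))
    g≢0 : g ≢ 0
    g≢0 g≡0 = m≢0 (trans m≡eg (trans (cong (e *_) g≡0) (ℕP.*-zeroʳ e)))
    1<g : 1 < g
    1<g = ℕP.≤∧≢⇒< (ℕP.n≢0⇒n>0 g≢0) (λ 1≡g → ¬i⊥m (gcd≡1⇒coprime (sym 1≡g)))
    e<m : e < m
    e<m = ≡.subst (e <_) (sym m≡eg) (ℕP.m<m*n e g {{ℕ.≢-nonZero e≢0}} 1<g)

  -- In the -+ case x * (m - 1) is the positive representative of -x.
  bézout-inverse : ∀ m₀ {a} → Coprime a (suc m₀) → ∃[ b ] (b * a) % suc m₀ ≡ 1 % suc m₀
  bézout-inverse m₀ {a} a⊥m with coprime-Bézout a⊥m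
  ... | Bézout.+- x y eq = x , (begin
    (x * a) % suc m₀              ≡⟨ cong (_% suc m₀) (sym eq) ⟩
    (1 + y * suc m₀) % suc m₀     ≡⟨ [m+kn]%n≡m%n 1 y (suc m₀) ⟩
    1 % suc m₀                    ∎)
  ... | Bézout.-+ x y eq = x * m₀ , (begin
    (x * m₀ * a) % m              ≡⟨ sym ([m+kn]%n≡m%n (x * m₀ * a) 1 m) ⟩
    (x * m₀ * a + 1 * m) % m      ≡⟨ cong (_% m) (expand x a m₀) ⟩
    (1 + (1 + x * a) * m₀) % m    ≡⟨ cong (λ t → (1 + t * m₀) % m) eq ⟩
    (1 + y * m * m₀) % m          ≡⟨ cong (λ t → (1 + t) % m) (swap y m m₀) ⟩
    (1 + y * m₀ * m) % m          ≡⟨ [m+kn]%n≡m%n 1 (y * m₀) m ⟩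
    1 % m                         ∎)
    where
    open +-*-Solver
    m = suc m₀
    expand : ∀ x a m₀ → x * m₀ * a + 1 * suc m₀ ≡ 1 + (1 + x * a) * m₀
    expand = solve 3 (λ x a m₀ → x :* m₀ :* a :+ con 1 :* (con 1 :+ m₀) := con 1 :+ (con 1 :+ x :* a) :* m₀) refl
    swap : ∀ y m m₀ → y * m * m₀ ≡ y * m₀ * m
    swap = solve 3 (λ y m m₀ → y :* m :* m₀ := y :* m₀ :* m) refl

  inverse-mod : ∀ {m a} .{{_ : NonZero m}} → Coprime a m → ∃[ b ] ∀ i → ((i * b) % m * a) % m ≡ i % m
  inverse-mod {suc m₀} {a} a⊥m with bézout-inverse m₀ a⊥m
  ... | b , ba≡1 = b , λ i → begin
    ((i * b) % m * a) % m              ≡⟨ %-distribˡ-* ((i * b) % m) a m ⟩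
    ((i * b) % m % m * (a % m)) % m    ≡⟨ cong (λ t → (t * (a % m)) % m) (m%n%n≡m%n (i * b) m) ⟩
    ((i * b) % m * (a % m)) % m        ≡⟨ sym (%-distribˡ-* (i * b) a m) ⟩
    (i * b * a) % m                    ≡⟨ cong (_% m) (ℕP.*-assoc i b a) ⟩
    (i * (b * a)) % m                  ≡⟨ %-distribˡ-* i (b * a) m ⟩
    ((i % m) * ((b * a) % m)) % m      ≡⟨ cong (λ t → ((i % m) * t) % m) ba≡1 ⟩
    ((i % m) * (1 % m)) % m            ≡⟨ sym (%-distribˡ-* i 1 m) ⟩
    (i * 1) % m                        ≡⟨ cong (_% m) (ℕP.*-identityʳ i) ⟩
    i % m                              ∎
    where m = suc m₀

  ¬¬-∀< : ∀ {a} {A : ℕ → Set a} n → (∀ i → i < n → ¬ ¬ A i) → ¬ ¬ (∀ i → i < n → A i)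
  ¬¬-∀< zero    _     ¬all = ¬all (λ _ ())
  ¬¬-∀< (suc n) ¬¬A<n ¬all = ¬¬-∀< n (λ i i<n → ¬¬A<n i (ℕP.m<n⇒m<1+n i<n)) λ A<n →
    ¬¬A<n n ℕP.≤-refl λ Aₙ → ¬all λ i i<1+n → [ A<n i , (λ { refl → Aₙ }) ]′ (ℕP.m<1+n⇒m<n∨m≡n i<1+n)

module IntegerPolynomial where

  open ≡ using (refl; cong; sym; trans)

  -- Coefficient lists, constant term first.
  Poly : Set
  Poly = List ℤ

  infixl 6 _⊕_ _⊝_
  infixl 7 _⊗_
  infixl 8 _∘X^_

  _⊕_ : Poly → Poly → Poly
  []      ⊕ q       = q
  (a ∷ p) ⊕ []      = a ∷ p
  (a ∷ p) ⊕ (b ∷ q) = a ℤ.+ b ∷ p ⊕ q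

  scale : ℤ → Poly → Poly
  scale c = map (c ℤ.*_)

  _⊗_ : Poly → Poly → Poly
  []      ⊗ q = []
  (a ∷ p) ⊗ q = scale a q ⊕ (0ℤ ∷ p ⊗ q)

  _⊝_ : Poly → Poly → Poly
  p ⊝ q = p ⊕ scale -1ℤ q

  shift : ℕ → Poly → Poly
  shift n p = replicate n 0ℤ ++ p

  _∘X^_ : Poly → ℕ → Poly
  []      ∘X^ e = []
  (a ∷ p) ∘X^ e = (a ∷ []) ⊕ shift e (p ∘X^ e)

  1ₚ : Poly
  1ₚ = 1ℤ ∷ []

  X : Poly
  X = 0ℤ ∷ 1ₚ

  Xⁿ-1 : ℕ → Poly
  Xⁿ-1 n = shift n 1ₚ ⊝ 1ₚ

  ∏Xᵈ-1 : ℕ → Poly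
  ∏Xᵈ-1 zero    = 1ₚ
  ∏Xᵈ-1 (suc n) = ∏Xᵈ-1 n ⊗ Xⁿ-1 (suc n)

  coeff : Poly → ℕ → ℤ
  coeff []      j       = 0ℤ
  coeff (a ∷ p) zero    = a
  coeff (a ∷ p) (suc j) = coeff p j

  IsZero : Poly → Set
  IsZero = All (_≡ 0ℤ)

  isZero? : ∀ p → Dec (IsZero p)
  isZero? = all? (ℤ._≟ 0ℤ)

  wrap : ℕ → Poly → Poly
  wrap m p = take m p ⊕ drop m p

  reduce : ℕ → Poly → Poly
  reduce m = foldr (λ a r → wrap m (a ∷ r)) []

  length-⊕ : ∀ {n} p q → length p ≤ n → length q ≤ n → length (p ⊕ q) ≤ n
  length-⊕ []      q       _         q≤n       = q≤n
  length-⊕ (a ∷ p) []      p≤n       _         = p≤n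
  length-⊕ (a ∷ p) (b ∷ q) (s≤s p≤n) (s≤s q≤n) = s≤s (length-⊕ p q p≤n q≤n)

  length-scale : ∀ c p → length (scale c p) ≡ length p
  length-scale c = length-map (c ℤ.*_)

  length-shift : ∀ n p → length (shift n p) ≡ n ℕ.+ length p
  length-shift n p = trans (length-++ (replicate n 0ℤ)) (cong (ℕ._+ length p) (length-replicate n))

  length-∷ʳ : ∀ (p : Poly) a → length (p ∷ʳ a) ≡ suc (length p)
  length-∷ʳ p a = trans (length-++ p {a ∷ []}) (ℕP.+-comm (length p) 1)

  length-Xⁿ-1 : ∀ n → length (Xⁿ-1 n) ≤ suc n
  length-Xⁿ-1 n = length-⊕ (shift n 1ₚ) _ (ℕP.≤-reflexive (trans (length-shift n 1ₚ) (ℕP.+-comm n 1))) (s≤s z≤n)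

  length-reduce : ∀ m .{{_ : NonZero m}} p → length (reduce m p) ≤ m
  length-reduce m []      = z≤n
  length-reduce m (a ∷ p) = length-⊕ (take m (a ∷ r)) (drop m (a ∷ r))
    (ℕP.≤-trans (ℕP.≤-reflexive (length-take m (a ∷ r))) (ℕP.m⊓n≤m m _))
    (ℕP.≤-trans (ℕP.≤-reflexive (length-drop m (a ∷ r))) (ℕP.≤-trans (ℕP.∸-monoˡ-≤ m (s≤s (length-reduce m p)))
      (ℕP.≤-trans (ℕP.≤-reflexive (ℕP.m+n∸n≡m 1 m)) (ℕ.>-nonZero⁻¹ m))))
    where r = reduce m p

  coeff-≥length : ∀ p {j} → length p ≤ j → coeff p j ≡ 0ℤ
  coeff-≥length []      _           = refl
  coeff-≥length (a ∷ p) (s≤s p≤j) = coeff-≥length p p≤j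

  coeff-scale : ∀ c p j → coeff (scale c p) j ≡ c ℤ.* coeff p j
  coeff-scale c []      j       = sym (ℤP.*-zeroʳ c)
  coeff-scale c (a ∷ p) zero    = refl
  coeff-scale c (a ∷ p) (suc j) = coeff-scale c p j

  coeff≡0⇒IsZero : ∀ p → (∀ j → j < length p → coeff p j ≡ 0ℤ) → IsZero p
  coeff≡0⇒IsZero []      _   = []
  coeff≡0⇒IsZero (a ∷ p) p≡0 = p≡0 0 (s≤s z≤n) ∷ coeff≡0⇒IsZero p (λ j j< → p≡0 (suc j) (s≤s j<))

  ¬IsZero⇒nonzero-coeff : ∀ p → ¬ IsZero p → ∃[ j ] j < length p × coeff p j ≢ 0ℤ
  ¬IsZero⇒nonzero-coeff []      p≢0 = contradiction [] p≢0
  ¬IsZero⇒nonzero-coeff (a ∷ p) p≢0 with a ℤ.≟ 0ℤ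
  ... | no a≢0  = 0 , s≤s z≤n , a≢0
  ... | yes a≡0 with ¬IsZero⇒nonzero-coeff p (λ p≡0 → p≢0 (a≡0 ∷ p≡0))
  ...   | j , j<p , pⱼ≢0 = suc j , s≤s j<p , pⱼ≢0

module RingLemmas {c ℓ} (R : CommutativeRing c ℓ) where

  open CommutativeRing R
  open SetoidReasoning setoid
  open RingProperties ring using (-1*x≈-x)
  open AbelianGroupProperties +-abelianGroup using (⁻¹-involutive; ε⁻¹≈ε; ⁻¹-∙-comm; x∙y⁻¹≈ε⇒x≈y; x≈y⇒x∙y⁻¹≈ε)
  open CommutativeSemigroupProperties +-commutativeSemigroup using () renaming (interchange to +-interchange; x∙yz≈y∙xz to x+[y+z]≈y+[x+z])
  open CommutativeSemigroupProperties *-commutativeSemigroup using () renaming (interchange to *-interchange)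

  infixr 8 _^_

  ιℕ : ℕ → Carrier
  ιℕ = ofℕ R

  ι : ℤ → Carrier
  ι = ofℤ R

  _^_ : Carrier → ℕ → Carrier
  _^_ = pow R

  ∑ : ℕ → (ℕ → Carrier) → Carrier
  ∑ = sumR R

  infix 5 ∑
  syntax ∑ n (λ i → f) = ∑[ i < n ] f

  private
    module Mult = SemiringMult semiring

    ιℕ≡×1 : ∀ n → ιℕ n ≡ n Mult.× 1#
    ιℕ≡×1 zero    = ≡.refl
    ιℕ≡×1 (suc n) = ≡.cong (λ t → 1# + t) (ιℕ≡×1 n)

  ιℕ-+ : ∀ m n → ιℕ (m ℕ.+ n) ≈ ιℕ m + ιℕ n
  ιℕ-+ m n rewrite ιℕ≡×1 (m ℕ.+ n) | ιℕ≡×1 m | ιℕ≡×1 n = Mult.×-homo-+ 1# m n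

  ιℕ-* : ∀ m n → ιℕ (m ℕ.* n) ≈ ιℕ m * ιℕ n
  ιℕ-* m n rewrite ιℕ≡×1 (m ℕ.* n) | ιℕ≡×1 m | ιℕ≡×1 n = Mult.×1-homo-* m n

  ι-⊖ : ∀ m n → ι (m ⊖ n) ≈ ιℕ m - ιℕ n
  ι-⊖ m       zero    = begin
    ι (m ⊖ 0)   ≡⟨ ≡.cong ι (ℤP.⊖-≥ {m} {0} ℕ.z≤n) ⟩
    ιℕ m        ≈⟨ sym (+-identityʳ _) ⟩
    ιℕ m + 0#   ≈⟨ +-congˡ (sym ε⁻¹≈ε) ⟩
    ιℕ m - 0#   ∎
  ι-⊖ zero    (suc n) = sym (+-identityˡ _)
  ι-⊖ (suc m) (suc n) = begin
    ι (suc m ⊖ suc n)                 ≡⟨ ≡.cong ι (ℤP.[1+m]⊖[1+n]≡m⊖n m n) ⟩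
    ι (m ⊖ n)                         ≈⟨ ι-⊖ m n ⟩
    ιℕ m - ιℕ n                       ≈⟨ sym (+-identityˡ _) ⟩
    0# + (ιℕ m - ιℕ n)                ≈⟨ +-congʳ (sym (-‿inverseʳ 1#)) ⟩
    (1# - 1#) + (ιℕ m - ιℕ n)         ≈⟨ +-interchange _ _ _ _ ⟩
    (1# + ιℕ m) + (- 1# - ιℕ n)       ≈⟨ +-congˡ (⁻¹-∙-comm _ _) ⟩
    (1# + ιℕ m) - (1# + ιℕ n)         ∎

  ι-+ : ∀ i j → ι (i ℤ.+ j) ≈ ι i + ι j
  ι-+ (+ m)    (+ n)    = ιℕ-+ m n
  ι-+ (+ m)    -[1+ n ] = ι-⊖ m (suc n)
  ι-+ -[1+ m ] (+ n)    = trans (ι-⊖ n (suc m)) (+-comm _ _)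
  ι-+ -[1+ m ] -[1+ n ] = begin
    - (1# + ιℕ (suc m ℕ.+ n))        ≈⟨ -‿cong (+-congˡ (ιℕ-+ (suc m) n)) ⟩
    - (1# + (ιℕ (suc m) + ιℕ n))     ≈⟨ -‿cong (x+[y+z]≈y+[x+z] 1# _ _) ⟩
    - (ιℕ (suc m) + ιℕ (suc n))      ≈⟨ sym (⁻¹-∙-comm _ _) ⟩
    - ιℕ (suc m) + - ιℕ (suc n)      ∎

  ι-neg : ∀ i → ι (ℤ.- i) ≈ - ι i
  ι-neg -[1+ n ] = sym (⁻¹-involutive _)
  ι-neg (+ zero) = sym ε⁻¹≈ε
  ι-neg (+ suc n) = refl

  private
    sgn : Sign → Carrier
    sgn Sign.+ = 1#
    sgn Sign.- = - 1#

    ι-◃ : ∀ s n → ι (s ℤ.◃ n) ≈ sgn s * ιℕ n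
    ι-◃ s        zero    = sym (zeroʳ _)
    ι-◃ Sign.+ (suc n) = sym (*-identityˡ _)
    ι-◃ Sign.- (suc n) = sym (-1*x≈-x _)

    ι≈sign*abs : ∀ i → ι i ≈ sgn (ℤ.sign i) * ιℕ ℤ.∣ i ∣
    ι≈sign*abs (+ n)    = sym (*-identityˡ _)
    ι≈sign*abs -[1+ n ] = sym (-1*x≈-x _)

    sgn-* : ∀ s t → sgn (s Sign.* t) ≈ sgn s * sgn t
    sgn-* Sign.+ t      = sym (*-identityˡ _)
    sgn-* Sign.- Sign.+ = sym (*-identityʳ _)
    sgn-* Sign.- Sign.- = sym (trans (-1*x≈-x _) (⁻¹-involutive 1#))

  ι-* : ∀ i j → ι (i ℤ.* j) ≈ ι i * ι j
  ι-* i j = begin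
    ι (i ℤ.* j)                                         ≈⟨ ι-◃ (ℤ.sign i Sign.* ℤ.sign j) (ℤ.∣ i ∣ ℕ.* ℤ.∣ j ∣) ⟩
    sgn (ℤ.sign i Sign.* ℤ.sign j) * ιℕ (ℤ.∣ i ∣ ℕ.* ℤ.∣ j ∣) ≈⟨ *-cong (sgn-* (ℤ.sign i) (ℤ.sign j)) (ιℕ-* ℤ.∣ i ∣ ℤ.∣ j ∣) ⟩
    (sgn (ℤ.sign i) * sgn (ℤ.sign j)) * (ιℕ ℤ.∣ i ∣ * ιℕ ℤ.∣ j ∣) ≈⟨ *-interchange _ _ _ _ ⟩
    (sgn (ℤ.sign i) * ιℕ ℤ.∣ i ∣) * (sgn (ℤ.sign j) * ιℕ ℤ.∣ j ∣) ≈⟨ sym (*-cong (ι≈sign*abs i) (ι≈sign*abs j)) ⟩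
    ι i * ι j                                           ∎

  private
    ι-morphism : CommutativeRing.rawRing ℤP.+-*-commutativeRing -Raw-AlmostCommutative⟶ fromCommutativeRing R
    ι-morphism = record { ⟦_⟧ = ι ; +-homo = ι-+ ; *-homo = ι-* ; -‿homo = ι-neg ; 0-homo = refl ; 1-homo = +-identityʳ 1# }

    ι-≟ : ∀ a b → Maybe.Maybe (ι a ≈ ι b)
    ι-≟ a b = Maybe.map (λ a≡b → reflexive (≡.cong ι a≡b)) (dec⇒maybe (a ℤ.≟ b))

  module Solver = RingSolver (CommutativeRing.rawRing ℤP.+-*-commutativeRing) (fromCommutativeRing R) ι-morphism ι-≟
    using (solve; _:+_; _:*_; _:-_; :-_; _:=_; con)

  private
    module Exp = SemiringExp semiring

    pow≡^ : ∀ x n → x ^ n ≡ x Exp.^ n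
    pow≡^ x zero    = ≡.refl
    pow≡^ x (suc n) = ≡.cong (x *_) (pow≡^ x n)

  ^-congˡ : ∀ {x y} n → x ≈ y → x ^ n ≈ y ^ n
  ^-congˡ {x} {y} n x≈y rewrite pow≡^ x n | pow≡^ y n = Exp.^-congˡ n x≈y

  ^-+ : ∀ x m n → x ^ (m ℕ.+ n) ≈ x ^ m * x ^ n
  ^-+ x m n rewrite pow≡^ x (m ℕ.+ n) | pow≡^ x m | pow≡^ x n = Exp.^-homo-* x m n

  ^-* : ∀ x m n → x ^ (m ℕ.* n) ≈ (x ^ m) ^ n
  ^-* x m n rewrite pow≡^ x (m ℕ.* n) | pow≡^ (x ^ m) n | pow≡^ x m = sym (Exp.^-assocʳ x m n)

  ^-distrib-* : ∀ x y n → (x * y) ^ n ≈ x ^ n * y ^ n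
  ^-distrib-* x y n rewrite pow≡^ (x * y) n | pow≡^ x n | pow≡^ y n = CommutativeSemiringExp.^-distrib-* commutativeSemiring x y n

  ^-comm : ∀ x m n → (x ^ m) ^ n ≈ (x ^ n) ^ m
  ^-comm x m n = trans (sym (^-* x m n)) (trans (reflexive (≡.cong (x ^_) (ℕP.*-comm m n))) (^-* x n m))

  1^n : ∀ n → 1# ^ n ≈ 1#
  1^n zero    = refl
  1^n (suc n) = trans (*-identityˡ _) (1^n n)

  0^n≈0 : ∀ n → .{{ℕ.NonZero n}} → 0# ^ n ≈ 0#
  0^n≈0 (suc n) = zeroˡ _

  ι-^ : ∀ a n → ι (a ℤ.^ n) ≈ ι a ^ n
  ι-^ a zero    = +-identityʳ 1#
  ι-^ a (suc n) = trans (ι-* a (a ℤ.^ n)) (*-congˡ (ι-^ a n))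

  ∑-cong : ∀ n {f g} → (∀ i → i < n → f i ≈ g i) → ∑ n f ≈ ∑ n g
  ∑-cong zero    f≈g = refl
  ∑-cong (suc n) f≈g = +-cong (∑-cong n (λ i i<n → f≈g i (ℕP.m<n⇒m<1+n i<n))) (f≈g n ℕP.≤-refl)

  ∑-cong′ : ∀ n {f g} → (∀ i → f i ≈ g i) → ∑ n f ≈ ∑ n g
  ∑-cong′ n f≈g = ∑-cong n (λ i _ → f≈g i)

  ∑-zero : ∀ n f → (∀ i → i < n → f i ≈ 0#) → ∑ n f ≈ 0#
  ∑-zero zero    f f≈0 = refl
  ∑-zero (suc n) f f≈0 = trans (+-cong (∑-zero n f (λ i i<n → f≈0 i (ℕP.m<n⇒m<1+n i<n))) (f≈0 n ℕP.≤-refl)) (+-identityˡ 0#)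

  ∑-head : ∀ n (f : ℕ → Carrier) → ∑[ i < suc n ] f i ≈ f 0 + (∑[ i < n ] f (suc i))
  ∑-head zero    f = +-comm _ _
  ∑-head (suc n) f = trans (+-congʳ (∑-head n f)) (+-assoc (f 0) (∑[ i < n ] f (suc i)) (f (suc n)))

  ∑-rotate : ∀ n (f : ℕ → Carrier) → f n ≈ f 0 → ∑[ i < n ] f (suc i) ≈ ∑ n f
  ∑-rotate zero    f fₙ≈f₀ = refl
  ∑-rotate (suc n) f fₙ≈f₀ = trans (+-congˡ fₙ≈f₀) (trans (+-comm _ _) (sym (∑-head n f)))

  ∑-+ : ∀ n f g → ∑[ i < n ] (f i + g i) ≈ ∑ n f + ∑ n g
  ∑-+ zero    f g = sym (+-identityˡ _)
  ∑-+ (suc n) f g = trans (+-congʳ (∑-+ n f g)) (solve 4 (λ a b x y → (a :+ b) :+ (x :+ y) := (a :+ x) :+ (b :+ y)) refl _ _ _ _)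
    where open Solver

  ∑-*ˡ : ∀ n a f → a * ∑ n f ≈ ∑[ i < n ] (a * f i)
  ∑-*ˡ zero    a f = zeroʳ a
  ∑-*ˡ (suc n) a f = trans (distribˡ _ _ _) (+-congʳ (∑-*ˡ n a f))

  ∑-*ʳ : ∀ n a f → ∑ n f * a ≈ ∑[ i < n ] (f i * a)
  ∑-*ʳ n a f = trans (*-comm _ _) (trans (∑-*ˡ n a f) (∑-cong′ n (λ i → *-comm _ _)))

  ∑-swap : ∀ m n (f : ℕ → ℕ → Carrier) → ∑[ i < m ] ∑[ j < n ] f i j ≈ ∑[ j < n ] ∑[ i < m ] f i j
  ∑-swap zero    n f = sym (∑-zero n _ (λ _ _ → refl))
  ∑-swap (suc m) n f = trans (+-congʳ (∑-swap m n f)) (sym (∑-+ n _ _))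

  ∑-delta : ∀ n l f → l < n → (∀ i → i < n → i ≢ l → f i ≈ 0#) → ∑ n f ≈ f l
  ∑-delta zero    l f () _
  ∑-delta (suc n) l f l<n f≈0 with l ℕP.≟ n
  ... | yes ≡.refl = trans (+-congʳ (∑-zero n f (λ i i<n → f≈0 i (ℕP.m<n⇒m<1+n i<n) (ℕP.<⇒≢ i<n)))) (+-identityˡ _)
  ... | no l≢n     = trans (+-cong (∑-delta n l f (ℕP.≤∧≢⇒< (ℕP.≤-pred l<n) l≢n) (λ i i<n → f≈0 i (ℕP.m<n⇒m<1+n i<n)))
                                    (f≈0 n ℕP.≤-refl (λ n≡l → l≢n (≡.sym n≡l))))
                           (+-identityʳ _)

  ∑-extend : ∀ n {m} f → n ≤ m → (∀ j → n ≤ j → f j ≈ 0#) → ∑ m f ≈ ∑ n f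
  ∑-extend n {m} f n≤m f≈0 = trans (reflexive (≡.cong (λ k → ∑ k f) (≡.sym (ℕP.m+[n∸m]≡n n≤m)))) (extend (m ℕ.∸ n))
    where
    extend : ∀ d → ∑ (n ℕ.+ d) f ≈ ∑ n f
    extend zero    = reflexive (≡.cong (λ k → ∑ k f) (ℕP.+-identityʳ n))
    extend (suc d) = begin
      ∑ (n ℕ.+ suc d) f          ≡⟨ ≡.cong (λ k → ∑ k f) (ℕP.+-suc n d) ⟩
      ∑ (n ℕ.+ d) f + f (n ℕ.+ d) ≈⟨ +-cong (extend d) (f≈0 (n ℕ.+ d) (ℕP.m≤m+n n d)) ⟩
      ∑ n f + 0#                 ≈⟨ +-identityʳ _ ⟩
      ∑ n f                      ∎

  private
    module Binomial = CommutativeSemiringBinomial commutativeSemiring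
    open RawMonoidDefinitions +-rawMonoid using (sum)

    ∑≈sum : ∀ n (f : ℕ → Carrier) → ∑ n f ≈ sum {n} (λ i → f (toℕ i))
    ∑≈sum zero    f = refl
    ∑≈sum (suc n) f = trans (∑-head n f) (+-congˡ (∑≈sum n (λ i → f (suc i))))

    ×≈ιℕ* : ∀ m x → m Mult.× x ≈ ιℕ m * x
    ×≈ιℕ* m x = begin
      m Mult.× x            ≈⟨ Mult.×-congʳ m (sym (*-identityˡ x)) ⟩
      m Mult.× (1# * x)     ≈⟨ sym (Mult.×-assoc-* m 1# x) ⟩
      (m Mult.× 1#) * x     ≡⟨ ≡.cong (_* x) (≡.sym (ιℕ≡×1 m)) ⟩
      ιℕ m * x              ∎

  binomial-theorem : ∀ n a b → (a + b) ^ n ≈ ∑[ k < suc n ] ιℕ (n C k) * (a ^ k * b ^ (n ℕ.∸ k))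
  binomial-theorem n a b = begin
    (a + b) ^ n                                                     ≡⟨ pow≡^ (a + b) n ⟩
    (a + b) Exp.^ n                                                 ≈⟨ Binomial.theorem n a b ⟩
    Binomial.binomialExpansion a b n                                ≈⟨ sym (∑≈sum (suc n) _) ⟩
    ∑[ k < suc n ] (n C k) Mult.× (a Exp.^ k * b Exp.^ (n ℕ.∸ k))   ≈⟨ ∑-cong′ (suc n) (λ k → trans (×≈ιℕ* (n C k) _)
                                                                         (*-congˡ (reflexive (≡.sym (≡.cong₂ _*_ (pow≡^ a k) (pow≡^ b (n ℕ.∸ k))))))) ⟩
    ∑[ k < suc n ] ιℕ (n C k) * (a ^ k * b ^ (n ℕ.∸ k))             ∎

  ι-sumℤ : ∀ n f → ι (sumℤ n f) ≈ ∑[ i < n ] ι (f i)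
  ι-sumℤ zero    f = refl
  ι-sumℤ (suc n) f = trans (ι-+ (sumℤ n f) (f n)) (+-congʳ (ι-sumℤ n f))

  x≈y⇒x-y≈0 : ∀ {x y} → x ≈ y → x - y ≈ 0#
  x≈y⇒x-y≈0 = x≈y⇒x∙y⁻¹≈ε

  x-y≈0⇒x≈y : ∀ {x y} → x - y ≈ 0# → x ≈ y
  x-y≈0⇒x≈y = x∙y⁻¹≈ε⇒x≈y _ _

module Evaluation {c ℓ} (R : CommutativeRing c ℓ) where

  open CommutativeRing R
  open SetoidReasoning setoid
  open RingProperties ring using (-1*x≈-x)
  open CommutativeSemigroupProperties *-commutativeSemigroup using (x∙yz≈y∙xz)
  open IntegerPolynomial
  open RingLemmas R

  ⟦_⟧ : Poly → Carrier → Carrier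
  ⟦ []    ⟧ x = 0#
  ⟦ a ∷ p ⟧ x = ι a + x * ⟦ p ⟧ x

  ⟦⟧-cong : ∀ p {x y} → x ≈ y → ⟦ p ⟧ x ≈ ⟦ p ⟧ y
  ⟦⟧-cong []      x≈y = refl
  ⟦⟧-cong (a ∷ p) x≈y = +-congˡ (*-cong x≈y (⟦⟧-cong p x≈y))

  ⟦⟧-const : ∀ a x → ⟦ a ∷ [] ⟧ x ≈ ι a
  ⟦⟧-const a x = trans (+-congˡ (zeroʳ x)) (+-identityʳ _)

  ⟦⟧-1ₚ : ∀ x → ⟦ 1ₚ ⟧ x ≈ 1#
  ⟦⟧-1ₚ x = trans (⟦⟧-const 1ℤ x) (+-identityʳ 1#)

  ⟦⟧-X : ∀ x → ⟦ X ⟧ x ≈ x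
  ⟦⟧-X x = trans (+-identityˡ _) (trans (*-congˡ (⟦⟧-1ₚ x)) (*-identityʳ x))

  ⟦⟧-⊕ : ∀ p q x → ⟦ p ⊕ q ⟧ x ≈ ⟦ p ⟧ x + ⟦ q ⟧ x
  ⟦⟧-⊕ []      q       x = sym (+-identityˡ _)
  ⟦⟧-⊕ (a ∷ p) []      x = sym (+-identityʳ _)
  ⟦⟧-⊕ (a ∷ p) (b ∷ q) x = begin
    ι (a ℤ.+ b) + x * ⟦ p ⊕ q ⟧ x           ≈⟨ +-cong (ι-+ a b) (*-congˡ (⟦⟧-⊕ p q x)) ⟩
    (ι a + ι b) + x * (⟦ p ⟧ x + ⟦ q ⟧ x)   ≈⟨ solve 5 (λ A B X P Q → (A :+ B) :+ X :* (P :+ Q) := (A :+ X :* P) :+ (B :+ X :* Q)) refl _ _ _ _ _ ⟩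
    (ι a + x * ⟦ p ⟧ x) + (ι b + x * ⟦ q ⟧ x) ∎
    where open Solver

  ⟦⟧-scale : ∀ a p x → ⟦ scale a p ⟧ x ≈ ι a * ⟦ p ⟧ x
  ⟦⟧-scale a []      x = sym (zeroʳ _)
  ⟦⟧-scale a (b ∷ p) x = begin
    ι (a ℤ.* b) + x * ⟦ scale a p ⟧ x  ≈⟨ +-cong (ι-* a b) (*-congˡ (⟦⟧-scale a p x)) ⟩
    ι a * ι b + x * (ι a * ⟦ p ⟧ x)    ≈⟨ solve 4 (λ A B X P → A :* B :+ X :* (A :* P) := A :* (B :+ X :* P)) refl _ _ _ _ ⟩
    ι a * (ι b + x * ⟦ p ⟧ x)          ∎
    where open Solver

  ⟦⟧-⊗ : ∀ p q x → ⟦ p ⊗ q ⟧ x ≈ ⟦ p ⟧ x * ⟦ q ⟧ x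
  ⟦⟧-⊗ []      q x = sym (zeroˡ _)
  ⟦⟧-⊗ (a ∷ p) q x = begin
    ⟦ scale a q ⊕ (0ℤ ∷ p ⊗ q) ⟧ x                ≈⟨ ⟦⟧-⊕ (scale a q) _ x ⟩
    ⟦ scale a q ⟧ x + (0# + x * ⟦ p ⊗ q ⟧ x)      ≈⟨ +-cong (⟦⟧-scale a q x) (trans (+-identityˡ _) (*-congˡ (⟦⟧-⊗ p q x))) ⟩
    ι a * ⟦ q ⟧ x + x * (⟦ p ⟧ x * ⟦ q ⟧ x)       ≈⟨ solve 4 (λ A Q X P → A :* Q :+ X :* (P :* Q) := (A :+ X :* P) :* Q) refl _ _ _ _ ⟩
    (ι a + x * ⟦ p ⟧ x) * ⟦ q ⟧ x                 ∎
    where open Solver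

  ⟦⟧-⊝ : ∀ p q x → ⟦ p ⊝ q ⟧ x ≈ ⟦ p ⟧ x - ⟦ q ⟧ x
  ⟦⟧-⊝ p q x = trans (⟦⟧-⊕ p _ x) (+-congˡ (trans (⟦⟧-scale -1ℤ q x) (trans (*-congʳ (-‿cong (+-identityʳ 1#))) (-1*x≈-x _))))

  ⟦⟧-shift : ∀ n p x → ⟦ shift n p ⟧ x ≈ x ^ n * ⟦ p ⟧ x
  ⟦⟧-shift zero    p x = sym (*-identityˡ _)
  ⟦⟧-shift (suc n) p x = trans (+-identityˡ _) (trans (*-congˡ (⟦⟧-shift n p x)) (sym (*-assoc _ _ _)))

  ⟦⟧-∘X^ : ∀ p e x → ⟦ p ∘X^ e ⟧ x ≈ ⟦ p ⟧ (x ^ e)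
  ⟦⟧-∘X^ []      e x = refl
  ⟦⟧-∘X^ (a ∷ p) e x = begin
    ⟦ (a ∷ []) ⊕ shift e (p ∘X^ e) ⟧ x       ≈⟨ ⟦⟧-⊕ (a ∷ []) (shift e (p ∘X^ e)) x ⟩
    ⟦ a ∷ [] ⟧ x + ⟦ shift e (p ∘X^ e) ⟧ x   ≈⟨ +-cong (⟦⟧-const a x) (⟦⟧-shift e _ x) ⟩
    ι a + x ^ e * ⟦ p ∘X^ e ⟧ x              ≈⟨ +-congˡ (*-congˡ (⟦⟧-∘X^ p e x)) ⟩
    ι a + x ^ e * ⟦ p ⟧ (x ^ e)              ∎

  ⟦⟧-Xⁿ-1 : ∀ n x → ⟦ Xⁿ-1 n ⟧ x ≈ x ^ n - 1#
  ⟦⟧-Xⁿ-1 n x = trans (⟦⟧-⊝ (shift n 1ₚ) 1ₚ x)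
    (+-cong (trans (⟦⟧-shift n 1ₚ x) (trans (*-congˡ (⟦⟧-1ₚ x)) (*-identityʳ _))) (-‿cong (⟦⟧-1ₚ x)))

  ⟦⟧-∷ʳ : ∀ p a x → ⟦ p ∷ʳ a ⟧ x ≈ ⟦ p ⟧ x + ι a * x ^ length p
  ⟦⟧-∷ʳ []      a x = trans (⟦⟧-const a x) (sym (trans (+-identityˡ _) (*-identityʳ _)))
  ⟦⟧-∷ʳ (b ∷ p) a x = begin
    ι b + x * ⟦ p ∷ʳ a ⟧ x                      ≈⟨ +-congˡ (*-congˡ (⟦⟧-∷ʳ p a x)) ⟩
    ι b + x * (⟦ p ⟧ x + ι a * x ^ length p)    ≈⟨ solve 5 (λ B X P A Y → B :+ X :* (P :+ A :* Y) := (B :+ X :* P) :+ A :* (X :* Y)) refl _ _ _ _ _ ⟩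
    (ι b + x * ⟦ p ⟧ x) + ι a * (x * x ^ length p) ∎
    where open Solver

  ⟦⟧-take-drop : ∀ m p x → ⟦ p ⟧ x ≈ ⟦ take m p ⟧ x + x ^ m * ⟦ drop m p ⟧ x
  ⟦⟧-take-drop zero    p       x = trans (sym (*-identityˡ _)) (sym (+-identityˡ _))
  ⟦⟧-take-drop (suc m) []      x = sym (trans (+-identityˡ _) (zeroʳ _))
  ⟦⟧-take-drop (suc m) (a ∷ p) x = begin
    ι a + x * ⟦ p ⟧ x                                          ≈⟨ +-congˡ (*-congˡ (⟦⟧-take-drop m p x)) ⟩
    ι a + x * (⟦ take m p ⟧ x + x ^ m * ⟦ drop m p ⟧ x)         ≈⟨ solve 5 (λ A X T Y D → A :+ X :* (T :+ Y :* D) := (A :+ X :* T) :+ (X :* Y) :* D) refl _ _ _ _ _ ⟩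
    (ι a + x * ⟦ take m p ⟧ x) + (x * x ^ m) * ⟦ drop m p ⟧ x  ∎
    where open Solver

  ⟦⟧-wrap : ∀ m {ζ} → ζ ^ m ≈ 1# → ∀ p → ⟦ wrap m p ⟧ ζ ≈ ⟦ p ⟧ ζ
  ⟦⟧-wrap m {ζ} ζᵐ≈1 p = begin
    ⟦ take m p ⊕ drop m p ⟧ ζ                    ≈⟨ ⟦⟧-⊕ (take m p) _ ζ ⟩
    ⟦ take m p ⟧ ζ + ⟦ drop m p ⟧ ζ              ≈⟨ +-congˡ (sym (trans (*-congʳ ζᵐ≈1) (*-identityˡ _))) ⟩
    ⟦ take m p ⟧ ζ + ζ ^ m * ⟦ drop m p ⟧ ζ      ≈⟨ sym (⟦⟧-take-drop m p ζ) ⟩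
    ⟦ p ⟧ ζ                                      ∎

  ⟦⟧-reduce : ∀ m {ζ} → ζ ^ m ≈ 1# → ∀ p → ⟦ reduce m p ⟧ ζ ≈ ⟦ p ⟧ ζ
  ⟦⟧-reduce m ζᵐ≈1 []      = refl
  ⟦⟧-reduce m ζᵐ≈1 (a ∷ p) = trans (⟦⟧-wrap m ζᵐ≈1 (a ∷ reduce m p)) (+-congˡ (*-congˡ (⟦⟧-reduce m ζᵐ≈1 p)))

  ⟦⟧-coeffs : ∀ p {n} x → length p ≤ n → ⟦ p ⟧ x ≈ ∑[ j < n ] ι (coeff p j) * x ^ j
  ⟦⟧-coeffs p {n} x p≤n = trans (exact p) (sym (∑-extend (length p) _ p≤n
    (λ j p≤j → trans (*-congʳ (reflexive (≡.cong ι (coeff-≥length p p≤j)))) (zeroˡ _))))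
    where
    exact : ∀ p → ⟦ p ⟧ x ≈ ∑[ j < length p ] ι (coeff p j) * x ^ j
    exact []      = refl
    exact (a ∷ p) = begin
      ι a + x * ⟦ p ⟧ x                                              ≈⟨ +-congˡ (*-congˡ (exact p)) ⟩
      ι a + x * (∑[ j < length p ] ι (coeff p j) * x ^ j)            ≈⟨ +-cong (sym (*-identityʳ _)) (∑-*ˡ (length p) x _) ⟩
      ι a * 1# + (∑[ j < length p ] x * (ι (coeff p j) * x ^ j))     ≈⟨ +-congˡ (∑-cong′ (length p) (λ j → x∙yz≈y∙xz x _ _)) ⟩
      ι a * 1# + (∑[ j < length p ] ι (coeff p j) * x ^ suc j)       ≈⟨ sym (∑-head (length p) _) ⟩
      ∑[ j < length (a ∷ p) ] ι (coeff (a ∷ p) j) * x ^ j            ∎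

  ⟦⟧-applyUpTo : ∀ f n x → ⟦ applyUpTo f n ⟧ x ≈ ∑[ l < n ] ι (f l) * x ^ l
  ⟦⟧-applyUpTo f zero    x = refl
  ⟦⟧-applyUpTo f (suc n) x = begin
    ι (f 0) + x * ⟦ applyUpTo (λ l → f (suc l)) n ⟧ x              ≈⟨ +-cong (sym (*-identityʳ _)) (*-congˡ (⟦⟧-applyUpTo (λ l → f (suc l)) n x)) ⟩
    ι (f 0) * 1# + x * (∑[ l < n ] ι (f (suc l)) * x ^ l)          ≈⟨ +-congˡ (∑-*ˡ n x _) ⟩
    ι (f 0) * 1# + (∑[ l < n ] x * (ι (f (suc l)) * x ^ l))        ≈⟨ +-congˡ (∑-cong′ n (λ l → x∙yz≈y∙xz x _ _)) ⟩
    ι (f 0) * 1# + (∑[ l < n ] ι (f (suc l)) * x ^ suc l)          ≈⟨ sym (∑-head n _) ⟩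
    ∑[ l < suc n ] ι (f l) * x ^ l                                 ∎

  ⟦⟧-coeff-cong : ∀ p q {n} → length p ≤ n → length q ≤ n → (∀ l → l < n → coeff p l ≡ coeff q l) → ∀ x → ⟦ p ⟧ x ≈ ⟦ q ⟧ x
  ⟦⟧-coeff-cong p q {n} p≤n q≤n p≡q x = trans (⟦⟧-coeffs p x p≤n)
    (trans (∑-cong n (λ l l<n → *-congʳ (reflexive (≡.cong ι (p≡q l l<n))))) (sym (⟦⟧-coeffs q x q≤n)))

  IsZero⇒⟦⟧≈0 : ∀ {p} → IsZero p → ∀ x → ⟦ p ⟧ x ≈ 0#
  IsZero⇒⟦⟧≈0 []           x = refl
  IsZero⇒⟦⟧≈0 (≡.refl ∷ z) x = trans (+-identityˡ _) (trans (*-congˡ (IsZero⇒⟦⟧≈0 z x)) (zeroʳ x))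

module IntegerPolynomialFunctions {c ℓ} (R : CommutativeRing c ℓ) where

  open CommutativeRing R
  open SetoidReasoning setoid
  open IntegerPolynomial
  open RingLemmas R
  open Evaluation R

  Fun : Set c
  Fun = Carrier → Carrier

  IsIntPoly : Fun → Set (c ⊔ ℓ)
  IsIntPoly F = Σ Poly λ w → ∀ x → F x ≈ ⟦ w ⟧ x

  infix 4 _≡_mod_

  _≡_mod_ : Fun → Fun → ℕ → Set (c ⊔ ℓ)
  F ≡ G mod n = Σ Poly λ w → ∀ x → F x ≈ G x + ιℕ n * ⟦ w ⟧ x

  intPoly-⟦⟧ : ∀ p → IsIntPoly ⟦ p ⟧
  intPoly-⟦⟧ p = p , λ x → refl

  intPoly-ι : ∀ a → IsIntPoly (λ _ → ι a)
  intPoly-ι a = a ∷ [] , λ x → sym (⟦⟧-const a x)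

  intPoly-1 : IsIntPoly (λ _ → 1#)
  intPoly-1 = 1ₚ , λ x → sym (⟦⟧-1ₚ x)

  intPoly-id : IsIntPoly (λ x → x)
  intPoly-id = X , λ x → sym (⟦⟧-X x)

  intPoly-+ : ∀ {F G} → IsIntPoly F → IsIntPoly G → IsIntPoly (λ x → F x + G x)
  intPoly-+ (f , F≈) (g , G≈) = f ⊕ g , λ x → trans (+-cong (F≈ x) (G≈ x)) (sym (⟦⟧-⊕ f g x))

  intPoly-* : ∀ {F G} → IsIntPoly F → IsIntPoly G → IsIntPoly (λ x → F x * G x)
  intPoly-* (f , F≈) (g , G≈) = f ⊗ g , λ x → trans (*-cong (F≈ x) (G≈ x)) (sym (⟦⟧-⊗ f g x))

  intPoly-^ : ∀ {F} n → IsIntPoly F → IsIntPoly (λ x → F x ^ n)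
  intPoly-^ zero    _     = intPoly-1
  intPoly-^ (suc n) F-int = intPoly-* F-int (intPoly-^ n F-int)

  intPoly-∑ : ∀ n {F : ℕ → Fun} → (∀ k → IsIntPoly (F k)) → IsIntPoly (λ x → ∑[ k < n ] F k x)
  intPoly-∑ zero    F-int = [] , λ x → refl
  intPoly-∑ (suc n) F-int = intPoly-+ (intPoly-∑ n F-int) (F-int n)

  module CongruenceMod (n : ℕ) where

    ≈⇒≡mod : ∀ {F G} → (∀ x → F x ≈ G x) → F ≡ G mod n
    ≈⇒≡mod F≈G = [] , λ x → trans (F≈G x) (sym (trans (+-congˡ (zeroʳ _)) (+-identityʳ _)))

    ≡mod-sym : ∀ {F G} → F ≡ G mod n → G ≡ F mod n
    ≡mod-sym {F} {G} (w , F≈) = scale -1ℤ w , λ x → begin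
      G x                                          ≈⟨ solve 3 (λ g n w → g := (g :+ n :* w) :+ n :* (con -1ℤ :* w)) refl (G x) (ιℕ n) (⟦ w ⟧ x) ⟩
      (G x + ιℕ n * ⟦ w ⟧ x) + ιℕ n * (ι -1ℤ * ⟦ w ⟧ x) ≈⟨ +-cong (sym (F≈ x)) (*-congˡ (sym (⟦⟧-scale -1ℤ w x))) ⟩
      F x + ιℕ n * ⟦ scale -1ℤ w ⟧ x               ∎
      where open Solver

    ≡mod-neg : ∀ {F G} → F ≡ G mod n → (λ x → - F x) ≡ (λ x → - G x) mod n
    ≡mod-neg {F} {G} (w , F≈) = scale -1ℤ w , λ x → begin
      - F x                                   ≈⟨ -‿cong (F≈ x) ⟩
      - (G x + ιℕ n * ⟦ w ⟧ x)                 ≈⟨ solve 3 (λ g n w → :- (g :+ n :* w) := :- g :+ n :* (con -1ℤ :* w)) refl (G x) (ιℕ n) (⟦ w ⟧ x) ⟩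
      - G x + ιℕ n * (ι -1ℤ * ⟦ w ⟧ x)         ≈⟨ +-congˡ (*-congˡ (sym (⟦⟧-scale -1ℤ w x))) ⟩
      - G x + ιℕ n * ⟦ scale -1ℤ w ⟧ x        ∎
      where open Solver

    ≡mod-trans : ∀ {F G H} → F ≡ G mod n → G ≡ H mod n → F ≡ H mod n
    ≡mod-trans {F} {G} {H} (v , F≈) (w , G≈) = v ⊕ w , λ x → begin
      F x                                            ≈⟨ F≈ x ⟩
      G x + ιℕ n * ⟦ v ⟧ x                           ≈⟨ +-congʳ (G≈ x) ⟩
      H x + ιℕ n * ⟦ w ⟧ x + ιℕ n * ⟦ v ⟧ x          ≈⟨ solve 4 (λ h n w v → h :+ n :* w :+ n :* v := h :+ n :* (v :+ w)) refl _ _ _ _ ⟩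
      H x + ιℕ n * (⟦ v ⟧ x + ⟦ w ⟧ x)               ≈⟨ +-congˡ (*-congˡ (sym (⟦⟧-⊕ v w x))) ⟩
      H x + ιℕ n * ⟦ v ⊕ w ⟧ x                       ∎
      where open Solver

    ≡mod-+ : ∀ {F G F′ G′} → F ≡ G mod n → F′ ≡ G′ mod n → (λ x → F x + F′ x) ≡ (λ x → G x + G′ x) mod n
    ≡mod-+ {F} {G} {F′} {G′} (v , F≈) (w , F′≈) = v ⊕ w , λ x → begin
      F x + F′ x                                             ≈⟨ +-cong (F≈ x) (F′≈ x) ⟩
      (G x + ιℕ n * ⟦ v ⟧ x) + (G′ x + ιℕ n * ⟦ w ⟧ x)       ≈⟨ solve 5 (λ g g′ n v w → (g :+ n :* v) :+ (g′ :+ n :* w) := (g :+ g′) :+ n :* (v :+ w)) refl _ _ _ _ _ ⟩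
      (G x + G′ x) + ιℕ n * (⟦ v ⟧ x + ⟦ w ⟧ x)              ≈⟨ +-congˡ (*-congˡ (sym (⟦⟧-⊕ v w x))) ⟩
      (G x + G′ x) + ιℕ n * ⟦ v ⊕ w ⟧ x                      ∎
      where open Solver

    ≡mod-*ˡ : ∀ {H F G} → IsIntPoly H → F ≡ G mod n → (λ x → H x * F x) ≡ (λ x → H x * G x) mod n
    ≡mod-*ˡ {H} {F} {G} (h , H≈) (w , F≈) = h ⊗ w , λ x → begin
      H x * F x                                  ≈⟨ *-congˡ (F≈ x) ⟩
      H x * (G x + ιℕ n * ⟦ w ⟧ x)               ≈⟨ solve 4 (λ h g n w → h :* (g :+ n :* w) := h :* g :+ n :* (h :* w)) refl _ _ _ _ ⟩
      H x * G x + ιℕ n * (H x * ⟦ w ⟧ x)         ≈⟨ +-congˡ (*-congˡ (trans (*-congʳ (H≈ x)) (sym (⟦⟧-⊗ h w x)))) ⟩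
      H x * G x + ιℕ n * ⟦ h ⊗ w ⟧ x             ∎
      where open Solver

    ≡mod-*ʳ : ∀ {H F G} → IsIntPoly H → F ≡ G mod n → (λ x → F x * H x) ≡ (λ x → G x * H x) mod n
    ≡mod-*ʳ {H} {F} {G} H-int F≡G = ≡mod-trans (≈⇒≡mod (λ x → *-comm (F x) (H x)))
      (≡mod-trans (≡mod-*ˡ H-int F≡G) (≈⇒≡mod (λ x → *-comm (H x) (G x))))

    ≡mod-intPoly : ∀ {F G} → IsIntPoly G → F ≡ G mod n → IsIntPoly F
    ≡mod-intPoly G-int (w , F≈) = proj₁ G+nw-int , λ x → trans (F≈ x) (proj₂ G+nw-int x)
      where G+nw-int = intPoly-+ G-int (intPoly-* (intPoly-ι (+ n)) (intPoly-⟦⟧ w))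

    ≡mod-^ : ∀ {F G} k → IsIntPoly G → F ≡ G mod n → (λ x → F x ^ k) ≡ (λ x → G x ^ k) mod n
    ≡mod-^ zero    G-int F≡G = ≈⇒≡mod (λ x → refl)
    ≡mod-^ (suc k) G-int F≡G = ≡mod-trans (≡mod-*ˡ (≡mod-intPoly G-int F≡G) (≡mod-^ k G-int F≡G))
                                          (≡mod-*ʳ (intPoly-^ k G-int) F≡G)

    ≡mod-∘^ : ∀ {F G} e → F ≡ G mod n → (λ x → F (x ^ e)) ≡ (λ x → G (x ^ e)) mod n
    ≡mod-∘^ e (w , F≈) = w ∘X^ e , λ x → trans (F≈ (x ^ e)) (+-congˡ (*-congˡ (sym (⟦⟧-∘X^ w e x))))

module Frobenius {c ℓ} (R : CommutativeRing c ℓ) where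

  open NumberTheory using (prime∣pC[1+k])
  open CommutativeRing R
  open SetoidReasoning setoid
  open IntegerPolynomial
  open RingLemmas R
  open Evaluation R
  open IntegerPolynomialFunctions R

  freshman : ∀ {p} → Prime p → ∀ {F G} → IsIntPoly F → IsIntPoly G →
             (λ x → (F x + G x) ^ p) ≡ (λ x → F x ^ p + G x ^ p) mod p
  freshman {zero}   p-prime = contradiction p-prime ¬prime[0]
  freshman {suc p′} p-prime {F} {G} F-int G-int = proj₁ M-int , λ x → begin
    (F x + G x) ^ p                                    ≈⟨ binomial-theorem p (F x) (G x) ⟩
    ∑[ k < suc p ] T x k                               ≈⟨ ∑-head p (T x) ⟩
    T x 0 + ((∑[ k < p′ ] T x (suc k)) + T x p)        ≈⟨ +-cong (T₀ x) (+-cong (middle x) (Tₚ x)) ⟩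
    G x ^ p + (ιℕ p * M x + F x ^ p)                   ≈⟨ solve 4 (λ g q m f → g :+ (q :* m :+ f) := f :+ g :+ q :* m) refl _ _ _ _ ⟩
    F x ^ p + G x ^ p + ιℕ p * M x                     ≈⟨ +-congˡ (*-congˡ (proj₂ M-int x)) ⟩
    F x ^ p + G x ^ p + ιℕ p * ⟦ proj₁ M-int ⟧ x       ∎
    where
    open Solver
    p = suc p′
    T : Carrier → ℕ → Carrier
    T x k = ιℕ (p C k) * (F x ^ k * G x ^ (p ℕ.∸ k))
    M : Fun
    M x = ∑[ k < p′ ] ιℕ ((p C suc k) / p) * (F x ^ suc k * G x ^ (p′ ℕ.∸ k))
    M-int : IsIntPoly M
    M-int = intPoly-∑ p′ (λ k → intPoly-* (intPoly-ι (+ ((p C suc k) / p))) (intPoly-* (intPoly-^ (suc k) F-int) (intPoly-^ (p′ ℕ.∸ k) G-int)))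
    T₀ : ∀ x → T x 0 ≈ G x ^ p
    T₀ x = trans (*-congʳ (+-identityʳ 1#)) (trans (*-identityˡ _) (*-identityˡ _))
    Tₚ : ∀ x → T x p ≈ F x ^ p
    Tₚ x = begin
      ιℕ (p C p) * (F x ^ p * G x ^ (p ℕ.∸ p))  ≡⟨ ≡.cong₂ (λ m n → ιℕ m * (F x ^ p * G x ^ n)) (nCn≡1 p) (ℕP.n∸n≡0 p) ⟩
      ιℕ 1 * (F x ^ p * 1#)                     ≈⟨ trans (*-congʳ (+-identityʳ 1#)) (trans (*-identityˡ _) (*-identityʳ _)) ⟩
      F x ^ p                                   ∎
    middle : ∀ x → ∑[ k < p′ ] T x (suc k) ≈ ιℕ p * M x
    middle x = trans (∑-cong p′ (λ k k<p′ → begin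
        ιℕ (p C suc k) * Y k                       ≡⟨ ≡.cong (λ n → ιℕ n * Y k) (≡.sym (m*[n/m]≡n (prime∣pC[1+k] p-prime k<p′))) ⟩
        ιℕ (p ℕ.* ((p C suc k) / p)) * Y k         ≈⟨ trans (*-congʳ (ιℕ-* p ((p C suc k) / p))) (*-assoc _ _ _) ⟩
        ιℕ p * (ιℕ ((p C suc k) / p) * Y k)        ∎))
      (sym (∑-*ˡ p′ (ιℕ p) _))
      where
      Y : ℕ → Carrier
      Y k = F x ^ suc k * G x ^ (p′ ℕ.∸ k)

  fermat-ℕ : ∀ {p} → Prime p → ∀ n → (λ _ → ιℕ n ^ p) ≡ (λ _ → ιℕ n) mod p
  fermat-ℕ {p} p-prime zero    = ≈⇒≡mod (λ _ → 0^n≈0 p {{prime⇒nonZero p-prime}})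
    where open CongruenceMod p
  fermat-ℕ {p} p-prime (suc n) = ≡mod-trans (freshman p-prime intPoly-1 (intPoly-ι (+ n)))
                                            (≡mod-+ (≈⇒≡mod (λ _ → 1^n p)) (fermat-ℕ p-prime n))
    where open CongruenceMod p

  -- For a = -y with y > 0: (-y)ᵖ ≡ (y + -y)ᵖ - yᵖ ≡ -yᵖ ≡ -y.
  fermat : ∀ {p} → Prime p → ∀ a → (λ _ → ι a ^ p) ≡ (λ _ → ι a) mod p
  fermat p-prime (+ n)        = fermat-ℕ p-prime n
  fermat {p} p-prime -[1+ n ] = ≡mod-trans split (≡mod-trans (≡mod-+ (≡mod-sym 0≡yᵖ+[-y]ᵖ) (≈⇒≡mod (λ _ → refl)))
                                           (≡mod-trans (≈⇒≡mod (λ _ → +-identityˡ _)) (≡mod-neg (fermat-ℕ p-prime (suc n)))))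
    where
    open CongruenceMod p
    y = ιℕ (suc n)
    split : (λ _ → (- y) ^ p) ≡ (λ _ → (y ^ p + (- y) ^ p) - y ^ p) mod p
    split = ≈⇒≡mod (λ _ → solve 2 (λ a b → b := (a :+ b) :- a) refl (y ^ p) ((- y) ^ p))
      where open Solver
    0≡yᵖ+[-y]ᵖ : (λ _ → 0#) ≡ (λ _ → y ^ p + (- y) ^ p) mod p
    0≡yᵖ+[-y]ᵖ = ≡mod-trans (≈⇒≡mod (λ _ → sym (trans (^-congˡ p (-‿inverseʳ y)) (0^n≈0 p {{prime⇒nonZero p-prime}}))))
                            (freshman p-prime (intPoly-ι (+ suc n)) (intPoly-ι -[1+ n ]))

  frobenius : ∀ {p} → Prime p → ∀ u → (λ x → ⟦ u ⟧ x ^ p) ≡ (λ x → ⟦ u ⟧ (x ^ p)) mod p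
  frobenius {p} p-prime []      = ≈⇒≡mod (λ _ → 0^n≈0 p {{prime⇒nonZero p-prime}})
    where open CongruenceMod p
  frobenius {p} p-prime (a ∷ u) = ≡mod-trans (freshman p-prime (intPoly-ι a) (intPoly-* intPoly-id (intPoly-⟦⟧ u)))
    (≡mod-+ (fermat p-prime a) (≡mod-trans (≈⇒≡mod (λ x → ^-distrib-* x (⟦ u ⟧ x) p))
                                           (≡mod-*ˡ (intPoly-^ p intPoly-id) (frobenius p-prime u))))
    where open CongruenceMod p

  -- Frobenius applied twice, and then once more to the factor ⟦ w ⟧ x ^ p of ⟦ w ⟧ x ^ (p * p).
  frobenius² : ∀ {p} → Prime p → ∀ w →
    (λ x → ⟦ w ⟧ (x ^ (p ℕ.* p))) ≡ (λ x → ⟦ w ⟧ x * ⟦ w ⟧ (x ^ p) * ⟦ w ⟧ x ^ (p ℕ.* p ℕ.∸ suc p)) mod p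
  frobenius² {p} p-prime w = ≡mod-trans step₁ (≡mod-trans step₂ step₃)
    where
    open CongruenceMod p
    W = ⟦ w ⟧
    W-int = intPoly-⟦⟧ w
    K = p ℕ.* p ℕ.∸ suc p
    1+p≤p*p : suc p ≤ p ℕ.* p
    1+p≤p*p = ℕP.m<m*n p p {{prime⇒nonZero p-prime}} (ℕ.nonTrivial⇒n>1 p {{prime⇒nonTrivial p-prime}})
    step₁ : (λ x → W (x ^ (p ℕ.* p))) ≡ (λ x → W (x ^ p) ^ p) mod p
    step₁ = ≡mod-trans (≈⇒≡mod (λ x → ⟦⟧-cong w (^-* x p p))) (≡mod-sym (≡mod-∘^ p (frobenius p-prime w)))
    step₂ : (λ x → W (x ^ p) ^ p) ≡ (λ x → W x * W x ^ p * W x ^ K) mod p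
    step₂ = ≡mod-trans (≡mod-^ p (intPoly-^ p W-int) (≡mod-sym (frobenius p-prime w)))
      (≈⇒≡mod (λ x → trans (sym (^-* (W x) p p))
                    (trans (reflexive (≡.cong (W x ^_) (≡.sym (ℕP.m+[n∸m]≡n 1+p≤p*p)))) (^-+ (W x) (suc p) K))))
    step₃ : (λ x → W x * W x ^ p * W x ^ K) ≡ (λ x → W x * W (x ^ p) * W x ^ K) mod p
    step₃ = ≡mod-*ʳ (intPoly-^ K W-int) (≡mod-*ˡ W-int (frobenius p-prime w))

module Char0Domain {c ℓ} (R : CommutativeRing c ℓ) (dom : IsChar0Domain R) where

  open CommutativeRing R
  open SetoidReasoning setoid
  open AbelianGroupProperties +-abelianGroup using (⁻¹-involutive; ε⁻¹≈ε)
  open CommutativeSemigroupProperties *-commutativeSemigroup using (x∙yz≈y∙xz)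
  open RingWithoutOneProperties (Ring.ringWithoutOne ring) using (x[y-z]≈xy-xz; [y-z]x≈yx-zx)
  open IsChar0Domain dom
  open IntegerPolynomial
  open RingLemmas R
  open Evaluation R

  *-cancelˡ : ∀ {a x y} → a ≉ 0# → a * x ≈ a * y → x ≈ y
  *-cancelˡ {a} {x} {y} a≉0 ax≈ay = [ (λ a≈0 → contradiction a≈0 a≉0) , x-y≈0⇒x≈y ]′
    (noZeroDivisors a (x - y) (trans (x[y-z]≈xy-xz a x y) (x≈y⇒x-y≈0 ax≈ay)))

  *-≉0 : ∀ {a b} → a ≉ 0# → b ≉ 0# → a * b ≉ 0#
  *-≉0 a≉0 b≉0 ab≈0 = [ a≉0 , b≉0 ]′ (noZeroDivisors _ _ ab≈0)

  ^-≉0 : ∀ {a} n → a ≉ 0# → a ^ n ≉ 0#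
  ^-≉0 zero    a≉0 = nontrivial
  ^-≉0 (suc n) a≉0 = *-≉0 a≉0 (^-≉0 n a≉0)

  ιℕ-≉0 : ∀ n → .{{NonZero n}} → ιℕ n ≉ 0#
  ιℕ-≉0 (suc n) = char0 n

  ι≈0⇒≡0 : ∀ a → ι a ≈ 0# → a ≡ 0ℤ
  ι≈0⇒≡0 (+ zero)  _    = ≡.refl
  ι≈0⇒≡0 (+ suc n) ιa≈0 = contradiction ιa≈0 (char0 n)
  ι≈0⇒≡0 -[1+ n ]  ιa≈0 = contradiction (trans (sym (⁻¹-involutive _)) (trans (-‿cong ιa≈0) ε⁻¹≈ε)) (char0 n)

  ι-injective : ∀ a b → ι a ≈ ι b → a ≡ b
  ι-injective a b ιa≈ιb = ℤP.i-j≡0⇒i≡j a b (ι≈0⇒≡0 _ (trans (ι-+ a (ℤ.- b)) (trans (+-congˡ (ι-neg b)) (x≈y⇒x-y≈0 ιa≈ιb))))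

  ι-≉0 : ∀ {a} → a ≢ 0ℤ → ι a ≉ 0#
  ι-≉0 a≢0 ιa≈0 = a≢0 (ι≈0⇒≡0 _ ιa≈0)

  geometric-sum : ∀ ζ n → (ζ - 1#) * (∑[ i < n ] ζ ^ i) ≈ ζ ^ n - 1#
  geometric-sum ζ zero    = trans (zeroʳ _) (sym (-‿inverseʳ 1#))
  geometric-sum ζ (suc n) = begin
    (ζ - 1#) * ((∑[ i < n ] ζ ^ i) + ζ ^ n)            ≈⟨ distribˡ _ _ _ ⟩
    (ζ - 1#) * (∑[ i < n ] ζ ^ i) + (ζ - 1#) * ζ ^ n   ≈⟨ +-congʳ (geometric-sum ζ n) ⟩
    (ζ ^ n - 1#) + (ζ - 1#) * ζ ^ n                    ≈⟨ +-congˡ (trans ([y-z]x≈yx-zx (ζ ^ n) ζ 1#) (+-congˡ (-‿cong (*-identityˡ _)))) ⟩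
    (ζ ^ n - 1#) + (ζ * ζ ^ n - ζ ^ n)                 ≈⟨ solve 3 (λ y o z → (y :- o) :+ (z :- y) := z :- o) refl (ζ ^ n) 1# (ζ * ζ ^ n) ⟩
    ζ * ζ ^ n - 1#                                     ∎
    where open Solver

  ∑-powers-of-root≈0 : ∀ ζ m → ζ ^ m ≈ 1# → ζ ≉ 1# → ∑[ i < m ] ζ ^ i ≈ 0#
  ∑-powers-of-root≈0 ζ m ζᵐ≈1 ζ≉1 = [ (λ ζ-1≈0 → contradiction (x-y≈0⇒x≈y ζ-1≈0) ζ≉1) , id ]′
    (noZeroDivisors (ζ - 1#) _ (trans (geometric-sum ζ m) (x≈y⇒x-y≈0 ζᵐ≈1)))

  ∑-powers-of-1 : ∀ n → ∑[ i < n ] 1# ^ i ≈ ιℕ n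
  ∑-powers-of-1 zero    = refl
  ∑-powers-of-1 (suc n) = trans (+-cong (∑-powers-of-1 n) (1^n n)) (+-comm _ _)

  module PrimitiveRoot {m : ℕ} .{{_ : NonZero m}} {η : Carrier} (η-primitive : IsPrimitiveRoot R m η) where

    open IsPrimitiveRoot η-primitive

    η^[q*m]≈1 : ∀ q → η ^ (q ℕ.* m) ≈ 1#
    η^[q*m]≈1 q = trans (reflexive (≡.cong (η ^_) (ℕP.*-comm q m))) (trans (^-* η m q) (trans (^-congˡ q root) (1^n q)))

    η^n≈η^[n%m] : ∀ n → η ^ n ≈ η ^ (n % m)
    η^n≈η^[n%m] n = begin
      η ^ n                                  ≡⟨ ≡.cong (η ^_) (m≡m%n+[m/n]*n n m) ⟩
      η ^ (n % m ℕ.+ (n / m) ℕ.* m)          ≈⟨ ^-+ η (n % m) _ ⟩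
      η ^ (n % m) * η ^ ((n / m) ℕ.* m)      ≈⟨ *-congˡ (η^[q*m]≈1 (n / m)) ⟩
      η ^ (n % m) * 1#                       ≈⟨ *-identityʳ _ ⟩
      η ^ (n % m)                            ∎

    η^n≈1⇒m∣n : ∀ n → η ^ n ≈ 1# → m ∣ n
    η^n≈1⇒m∣n n ηⁿ≈1 with n % m ℕP.≟ 0
    ... | yes n%m≡0 = m%n≡0⇒n∣m n m n%m≡0
    ... | no  n%m≢0 = contradiction (trans (sym (η^n≈η^[n%m] n)) ηⁿ≈1) (minimal (n % m) (ℕP.n≢0⇒n>0 n%m≢0) (m%n<n n m))

    [η^a]^m≈1 : ∀ a → (η ^ a) ^ m ≈ 1#
    [η^a]^m≈1 a = trans (^-comm η a m) (trans (^-congˡ a root) (1^n a))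

    coprime⇒primitive : ∀ {a} → Coprime a m → IsPrimitiveRoot R m (η ^ a)
    coprime⇒primitive {a} a⊥m = record { root = [η^a]^m≈1 a ; minimal = λ j 1≤j j<m [η^a]ʲ≈1 →
      ℕP.<⇒≱ j<m (∣⇒≤ {{ℕ.>-nonZero 1≤j}} (coprime-divisor (Coprimality.sym a⊥m) (η^n≈1⇒m∣n (a ℕ.* j) (trans (^-* η a j) [η^a]ʲ≈1)))) }

    ^-divisor-primitive : ∀ {n d} .{{_ : NonZero d}} → m ≡ n ℕ.* d → IsPrimitiveRoot R n (η ^ d)
    ^-divisor-primitive {n} {d} m≡nd = record
      { root    = trans (sym (^-* η d n)) (trans (reflexive (≡.cong (η ^_) (≡.trans (ℕP.*-comm d n) (≡.sym m≡nd)))) root)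
      ; minimal = λ j 1≤j j<n [ηᵈ]ʲ≈1 → minimal (d ℕ.* j) (ℕP.*-mono-≤ (ℕ.>-nonZero⁻¹ d) 1≤j)
          (ℕP.<-≤-trans (ℕP.*-monoʳ-< d j<n) (ℕP.≤-reflexive (≡.trans (ℕP.*-comm d n) (≡.sym m≡nd)))) (trans (^-* η d j) [ηᵈ]ʲ≈1) }

    η≉0 : η ≉ 0#
    η≉0 η≈0 = nontrivial (trans (sym root) (trans (^-congˡ m η≈0) (0^n≈0 m)))

    private
      ^-injective-≤ : ∀ {i j} → i ≤ j → j < m → η ^ i ≈ η ^ j → i ≡ j
      ^-injective-≤ {i} {j} i≤j j<m ηⁱ≈ηʲ with j ℕ.∸ i ℕP.≟ 0
      ... | yes j∸i≡0 = ℕP.≤-antisym i≤j (ℕP.m∸n≡0⇒m≤n j∸i≡0)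
      ... | no  j∸i≢0 = contradiction ηʲ⁻ⁱ≈1 (minimal (j ℕ.∸ i) (ℕP.n≢0⇒n>0 j∸i≢0) (ℕP.≤-<-trans (ℕP.m∸n≤m j i) j<m))
        where
        ηʲ⁻ⁱ≈1 : η ^ (j ℕ.∸ i) ≈ 1#
        ηʲ⁻ⁱ≈1 = *-cancelˡ (^-≉0 i η≉0) (begin
          η ^ i * η ^ (j ℕ.∸ i)   ≈⟨ sym (^-+ η i _) ⟩
          η ^ (i ℕ.+ (j ℕ.∸ i))   ≡⟨ ≡.cong (η ^_) (ℕP.m+[n∸m]≡n i≤j) ⟩
          η ^ j                   ≈⟨ sym ηⁱ≈ηʲ ⟩
          η ^ i                   ≈⟨ sym (*-identityʳ _) ⟩
          η ^ i * 1#              ∎)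

    ^-injective : ∀ {i j} → i < m → j < m → η ^ i ≈ η ^ j → i ≡ j
    ^-injective {i} {j} i<m j<m ηⁱ≈ηʲ with ℕP.≤-total i j
    ... | inj₁ i≤j = ^-injective-≤ i≤j j<m ηⁱ≈ηʲ
    ... | inj₂ j≤i = ≡.sym (^-injective-≤ j≤i i<m (sym ηⁱ≈ηʲ))

    -- η ^ (m ∸ l + j) is η ^ (j - l) read modulo m.
    η^[m∸l+j]≈1⇒l≡j : ∀ {l j} → l < m → j < m → η ^ (m ℕ.∸ l ℕ.+ j) ≈ 1# → l ≡ j
    η^[m∸l+j]≈1⇒l≡j {l} {j} l<m j<m ζ≈1 = ^-injective l<m j<m (begin
      η ^ l                              ≈⟨ sym (*-identityʳ _) ⟩
      η ^ l * 1#                         ≈⟨ *-congˡ (sym ζ≈1) ⟩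
      η ^ l * η ^ (m ℕ.∸ l ℕ.+ j)        ≈⟨ sym (^-+ η l _) ⟩
      η ^ (l ℕ.+ (m ℕ.∸ l ℕ.+ j))        ≡⟨ ≡.cong (η ^_) (≡.trans (≡.sym (ℕP.+-assoc l _ j)) (≡.cong (ℕ._+ j) (ℕP.m+[n∸m]≡n (ℕP.<⇒≤ l<m)))) ⟩
      η ^ (m ℕ.+ j)                      ≈⟨ ^-+ η m j ⟩
      η ^ m * η ^ j                      ≈⟨ trans (*-congʳ root) (*-identityˡ _) ⟩
      η ^ j                              ∎)

    inverse-dft : ∀ p {l} → length p ≤ m → l < m →
                  ∑[ i < m ] η ^ (i ℕ.* (m ℕ.∸ l)) * ⟦ p ⟧ (η ^ i) ≈ ιℕ m * ι (coeff p l)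
    inverse-dft p {l} p≤m l<m = begin
      ∑[ i < m ] η ^ (i ℕ.* (m ℕ.∸ l)) * ⟦ p ⟧ (η ^ i)                         ≈⟨ ∑-cong′ m (λ i → *-congˡ (⟦⟧-coeffs p (η ^ i) p≤m)) ⟩
      ∑[ i < m ] η ^ (i ℕ.* (m ℕ.∸ l)) * (∑[ j < m ] C j * (η ^ i) ^ j)        ≈⟨ ∑-cong′ m (λ i → ∑-*ˡ m _ _) ⟩
      ∑[ i < m ] ∑[ j < m ] η ^ (i ℕ.* (m ℕ.∸ l)) * (C j * (η ^ i) ^ j)        ≈⟨ ∑-swap m m _ ⟩
      ∑[ j < m ] ∑[ i < m ] η ^ (i ℕ.* (m ℕ.∸ l)) * (C j * (η ^ i) ^ j)        ≈⟨ ∑-cong′ m (λ j → trans (∑-cong′ m (λ i → regroup i j)) (sym (∑-*ˡ m _ _))) ⟩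
      ∑[ j < m ] C j * (∑[ i < m ] (η ^ (m ℕ.∸ l ℕ.+ j)) ^ i)                  ≈⟨ ∑-delta m l _ l<m (λ j j<m j≢l → trans (*-congˡ (off-diagonal j<m j≢l)) (zeroʳ _)) ⟩
      C l * (∑[ i < m ] (η ^ (m ℕ.∸ l ℕ.+ l)) ^ i)                             ≈⟨ *-congˡ diagonal ⟩
      C l * ιℕ m                                                               ≈⟨ *-comm _ _ ⟩
      ιℕ m * C l                                                               ∎
      where
      C : ℕ → Carrier
      C j = ι (coeff p j)
      regroup : ∀ i j → η ^ (i ℕ.* (m ℕ.∸ l)) * (C j * (η ^ i) ^ j) ≈ C j * (η ^ (m ℕ.∸ l ℕ.+ j)) ^ i
      regroup i j = trans (x∙yz≈y∙xz _ _ _) (*-congˡ (begin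
        η ^ (i ℕ.* (m ℕ.∸ l)) * (η ^ i) ^ j        ≈⟨ *-congˡ (sym (^-* η i j)) ⟩
        η ^ (i ℕ.* (m ℕ.∸ l)) * η ^ (i ℕ.* j)      ≈⟨ sym (^-+ η (i ℕ.* (m ℕ.∸ l)) (i ℕ.* j)) ⟩
        η ^ (i ℕ.* (m ℕ.∸ l) ℕ.+ i ℕ.* j)          ≡⟨ ≡.cong (η ^_) (≡.trans (≡.sym (ℕP.*-distribˡ-+ i (m ℕ.∸ l) j)) (ℕP.*-comm i (m ℕ.∸ l ℕ.+ j))) ⟩
        η ^ ((m ℕ.∸ l ℕ.+ j) ℕ.* i)                ≈⟨ ^-* η (m ℕ.∸ l ℕ.+ j) i ⟩
        (η ^ (m ℕ.∸ l ℕ.+ j)) ^ i                  ∎))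
      off-diagonal : ∀ {j} → j < m → j ≢ l → ∑[ i < m ] (η ^ (m ℕ.∸ l ℕ.+ j)) ^ i ≈ 0#
      off-diagonal {j} j<m j≢l = ∑-powers-of-root≈0 _ m ([η^a]^m≈1 (m ℕ.∸ l ℕ.+ j)) (λ ζ≈1 → j≢l (≡.sym (η^[m∸l+j]≈1⇒l≡j l<m j<m ζ≈1)))
      diagonal : ∑[ i < m ] (η ^ (m ℕ.∸ l ℕ.+ l)) ^ i ≈ ιℕ m
      diagonal = trans (∑-cong′ m (λ i → ^-congˡ i (trans (reflexive (≡.cong (η ^_) (ℕP.m∸n+n≡m (ℕP.<⇒≤ l<m)))) root)))
                       (∑-powers-of-1 m)

    coeff-determined-by-roots : ∀ p q → length p ≤ m → length q ≤ m →
      (∀ i → i < m → ⟦ p ⟧ (η ^ i) ≈ ⟦ q ⟧ (η ^ i)) → ∀ l → l < m → coeff p l ≡ coeff q l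
    coeff-determined-by-roots p q p≤m q≤m p≈q l l<m = ι-injective _ _ (*-cancelˡ (ιℕ-≉0 m) (begin
      ιℕ m * ι (coeff p l)                                ≈⟨ sym (inverse-dft p p≤m l<m) ⟩
      ∑[ i < m ] η ^ (i ℕ.* (m ℕ.∸ l)) * ⟦ p ⟧ (η ^ i)    ≈⟨ ∑-cong m (λ i i<m → *-congˡ (p≈q i i<m)) ⟩
      ∑[ i < m ] η ^ (i ℕ.* (m ℕ.∸ l)) * ⟦ q ⟧ (η ^ i)    ≈⟨ inverse-dft q q≤m l<m ⟩
      ιℕ m * ι (coeff q l)                                ∎))

    vanishing-on-roots⇒IsZero : ∀ p → length p ≤ m → (∀ i → i < m → ⟦ p ⟧ (η ^ i) ≈ 0#) → IsZero p
    vanishing-on-roots⇒IsZero p p≤m p≈0 = coeff≡0⇒IsZero p (λ j j<p →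
      coeff-determined-by-roots p [] p≤m ℕ.z≤n p≈0 j (ℕP.<-≤-trans j<p p≤m))

module MinimalPolynomials {c ℓ} (R : CommutativeRing c ℓ) (dom : IsChar0Domain R) where

  open CommutativeRing R
  open SetoidReasoning setoid
  open IntegerPolynomial
  open RingLemmas R
  open Evaluation R
  open Char0Domain R dom

  record MinimalPolynomial (ξ : Carrier) : Set (c ⊔ ℓ) where
    field
      init    : Poly
      lead    : ℤ
      lead≢0  : lead ≢ 0ℤ
      root    : ⟦ init ∷ʳ lead ⟧ ξ ≈ 0#
      minimal : ∀ q → length q ≤ length init → ⟦ q ⟧ ξ ≈ 0# → IsZero q

    poly : Poly
    poly = init ∷ʳ lead

  ¬¬-minimalPolynomial : ∀ {ξ} q → ¬ IsZero q → ⟦ q ⟧ ξ ≈ 0# →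
    ¬ ¬ (Σ[ f ∈ MinimalPolynomial ξ ] length (MinimalPolynomial.init f) < length q)
  ¬¬-minimalPolynomial {ξ} q = search (length q) q ℕP.≤-refl
    where
    Found : Poly → Set (c ⊔ ℓ)
    Found q = Σ[ f ∈ MinimalPolynomial ξ ] length (MinimalPolynomial.init f) < length q

    ShorterRoot : ℕ → Set ℓ
    ShorterRoot n = ∃[ r ] length r < n × ¬ IsZero r × ⟦ r ⟧ ξ ≈ 0#

    shortest : ∀ q → ¬ IsZero q → ⟦ q ⟧ ξ ≈ 0# → ¬ ShorterRoot (length q) → Found q
    shortest q q≢0 qξ≈0 no-shorter with initLast q
    ... | []       = contradiction [] q≢0
    ... | q₀ ∷ʳ′ c = record { init = q₀ ; lead = c ; lead≢0 = c≢0 ; root = qξ≈0 ; minimal = minimal } , q₀<q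
      where
      q₀<q : length q₀ < length (q₀ ∷ʳ c)
      q₀<q = ℕP.≤-reflexive (≡.sym (length-∷ʳ q₀ c))
      c≢0 : c ≢ 0ℤ
      c≢0 ≡.refl = no-shorter (q₀ , q₀<q , (λ q₀≡0 → q≢0 (++⁺ q₀≡0 (≡.refl ∷ []))) ,
        trans (sym (trans (⟦⟧-∷ʳ q₀ 0ℤ ξ) (trans (+-congˡ (zeroˡ _)) (+-identityʳ _)))) qξ≈0)
      minimal : ∀ r → length r ≤ length q₀ → ⟦ r ⟧ ξ ≈ 0# → IsZero r
      minimal r r≤q₀ rξ≈0 = decidable-stable (isZero? r) (λ r≢0 → no-shorter (r , ℕP.≤-<-trans r≤q₀ q₀<q , r≢0 , rξ≈0))

    search : ∀ n q → length q ≤ n → ¬ IsZero q → ⟦ q ⟧ ξ ≈ 0# → ¬ ¬ Found q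
    search zero    []  _   q≢0 _    = contradiction [] q≢0
    search (suc n) q   q≤n q≢0 qξ≈0 ¬found = ¬¬-excluded-middle {A = ShorterRoot (length q)} λ
      { (yes (r , r<q , r≢0 , rξ≈0)) → search n r (ℕP.≤-pred (ℕP.≤-trans r<q q≤n)) r≢0 rξ≈0
                                         (λ (f , f<r) → ¬found (f , ℕP.<-trans f<r r<q))
      ; (no no-shorter)              → ¬found (shortest q q≢0 qξ≈0 no-shorter) }

  module _ {ξ} (f : MinimalPolynomial ξ) where

    open MinimalPolynomial f

    ι[lead]^≉0 : ∀ N → ι lead ^ N ≉ 0#
    ι[lead]^≉0 N = ^-≉0 N (ι-≉0 lead≢0)

    ¬IsZero-poly : ¬ IsZero poly
    ¬IsZero-poly poly≡0 = lead≢0 (All.head (++⁻ʳ init poly≡0))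

    1≤length-init : 1 ≤ length init
    1≤length-init with init | root
    ... | []    | leadξ≈0 = contradiction (trans (sym (⟦⟧-const lead ξ)) leadξ≈0) (ι-≉0 lead≢0)
    ... | _ ∷ _ | _       = s≤s z≤n

    -- lead · (q₀ ∷ʳ a) - a · Xᵉ · poly with its vanishing top coefficient dropped, where e = length q₀ ∸ length init.
    lower : Poly → ℤ → Poly
    lower q₀ a = scale lead q₀ ⊝ scale a (shift (length q₀ ℕ.∸ length init) init)

    length-lower : ∀ q₀ a → length init ≤ length q₀ → length (lower q₀ a) ≤ length q₀
    length-lower q₀ a init≤q₀ = length-⊕ (scale lead q₀) _ (ℕP.≤-reflexive (length-scale lead q₀))
      (ℕP.≤-reflexive (≡.trans (length-scale -1ℤ (scale a (shift e init))) (≡.trans (length-scale a (shift e init))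
        (≡.trans (length-shift e init) (ℕP.m∸n+n≡m init≤q₀)))))
      where e = length q₀ ℕ.∸ length init

    ⟦⟧-lower : ∀ q₀ a → length init ≤ length q₀ → ∀ x →
      ι lead * ⟦ q₀ ∷ʳ a ⟧ x ≈ ⟦ lower q₀ a ⟧ x + ι a * x ^ (length q₀ ℕ.∸ length init) * ⟦ poly ⟧ x
    ⟦⟧-lower q₀ a init≤q₀ x = begin
      ι lead * ⟦ q₀ ∷ʳ a ⟧ x                                                   ≈⟨ *-congˡ (⟦⟧-∷ʳ q₀ a x) ⟩
      ι lead * (⟦ q₀ ⟧ x + ι a * x ^ length q₀)                                ≈⟨ *-congˡ (+-congˡ (*-congˡ xᵉ⁺ⁿ)) ⟩
      ι lead * (⟦ q₀ ⟧ x + ι a * (x ^ e * x ^ length init))                    ≈⟨ solve 6 (λ L Q A E N I → L :* (Q :+ A :* (E :* N)) := (L :* Q :- A :* (E :* I)) :+ A :* E :* (I :+ L :* N)) refl _ _ _ _ _ _ ⟩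
      (ι lead * ⟦ q₀ ⟧ x - ι a * (x ^ e * ⟦ init ⟧ x)) + ι a * x ^ e * (⟦ init ⟧ x + ι lead * x ^ length init) ≈⟨ +-cong (sym ⟦lower⟧) (*-congˡ (sym (⟦⟧-∷ʳ init lead x))) ⟩
      ⟦ lower q₀ a ⟧ x + ι a * x ^ e * ⟦ poly ⟧ x                              ∎
      where
      open Solver
      e = length q₀ ℕ.∸ length init
      xᵉ⁺ⁿ : x ^ length q₀ ≈ x ^ e * x ^ length init
      xᵉ⁺ⁿ = trans (reflexive (≡.cong (x ^_) (≡.sym (ℕP.m∸n+n≡m init≤q₀)))) (^-+ x e _)
      ⟦lower⟧ : ⟦ lower q₀ a ⟧ x ≈ ι lead * ⟦ q₀ ⟧ x - ι a * (x ^ e * ⟦ init ⟧ x)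
      ⟦lower⟧ = trans (⟦⟧-⊝ (scale lead q₀) (scale a (shift e init)) x)
        (+-cong (⟦⟧-scale lead q₀ x) (-‿cong (trans (⟦⟧-scale a (shift e init) x) (*-congˡ (⟦⟧-shift e init x)))))

    record Multiple (q : Poly) : Set (c ⊔ ℓ) where
      field
        exponent        : ℕ
        cofactor        : Poly
        length-cofactor : length cofactor ≤ length q ℕ.∸ length init
        equation        : ∀ x → ι lead ^ exponent * ⟦ q ⟧ x ≈ ⟦ cofactor ⟧ x * ⟦ poly ⟧ x

    lower-root : ∀ q₀ a → length init ≤ length q₀ → ⟦ q₀ ∷ʳ a ⟧ ξ ≈ 0# → ⟦ lower q₀ a ⟧ ξ ≈ 0#
    lower-root q₀ a init≤q₀ qξ≈0 = begin
      ⟦ lower q₀ a ⟧ ξ                                                       ≈⟨ sym (+-identityʳ _) ⟩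
      ⟦ lower q₀ a ⟧ ξ + 0#                                                  ≈⟨ +-congˡ (sym (trans (*-congˡ root) (zeroʳ _))) ⟩
      ⟦ lower q₀ a ⟧ ξ + ι a * ξ ^ (length q₀ ℕ.∸ length init) * ⟦ poly ⟧ ξ  ≈⟨ sym (⟦⟧-lower q₀ a init≤q₀ ξ) ⟩
      ι lead * ⟦ q₀ ∷ʳ a ⟧ ξ                                                 ≈⟨ trans (*-congˡ qξ≈0) (zeroʳ _) ⟩
      0#                                                                     ∎

    short-root⇒multiple : ∀ q → length q ≤ length init → ⟦ q ⟧ ξ ≈ 0# → Multiple q
    short-root⇒multiple q q≤init qξ≈0 = record
      { exponent = 0 ; cofactor = [] ; length-cofactor = z≤n
      ; equation = λ x → trans (*-identityˡ _) (trans (IsZero⇒⟦⟧≈0 (minimal q q≤init qξ≈0) x) (sym (zeroˡ _))) }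

    lower-multiple⇒multiple : ∀ q₀ a → length init ≤ length q₀ → Multiple (lower q₀ a) → Multiple (q₀ ∷ʳ a)
    lower-multiple⇒multiple q₀ a init≤q₀ m₁ = record
      { exponent        = suc N
      ; cofactor        = s ⊕ shift e (lead ℤ.^ N ℤ.* a ∷ [])
      ; length-cofactor = ℕP.≤-trans
          (length-⊕ s _ (ℕP.≤-trans length-cofactor (ℕP.≤-trans (ℕP.∸-monoˡ-≤ (length init) (length-lower q₀ a init≤q₀)) (ℕP.n≤1+n e)))
                        (ℕP.≤-reflexive (≡.trans (length-shift e (lead ℤ.^ N ℤ.* a ∷ [])) (ℕP.+-comm e 1))))
          (ℕP.≤-reflexive (≡.sym (≡.trans (≡.cong (ℕ._∸ length init) (length-∷ʳ q₀ a)) (ℕP.+-∸-assoc 1 init≤q₀))))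
      ; equation        = λ x → begin
          (ι lead * L) * ⟦ q₀ ∷ʳ a ⟧ x                            ≈⟨ solve 3 (λ l L q → (l :* L) :* q := L :* (l :* q)) refl _ _ _ ⟩
          L * (ι lead * ⟦ q₀ ∷ʳ a ⟧ x)                            ≈⟨ *-congˡ (⟦⟧-lower q₀ a init≤q₀ x) ⟩
          L * (⟦ lower q₀ a ⟧ x + ι a * x ^ e * ⟦ poly ⟧ x)       ≈⟨ distribˡ _ _ _ ⟩
          L * ⟦ lower q₀ a ⟧ x + L * (ι a * x ^ e * ⟦ poly ⟧ x)   ≈⟨ +-congʳ (equation x) ⟩
          ⟦ s ⟧ x * ⟦ poly ⟧ x + L * (ι a * x ^ e * ⟦ poly ⟧ x)   ≈⟨ solve 5 (λ S F L A E → S :* F :+ L :* (A :* E :* F) := (S :+ E :* (L :* A)) :* F) refl _ _ _ _ _ ⟩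
          (⟦ s ⟧ x + x ^ e * (L * ι a)) * ⟦ poly ⟧ x              ≈⟨ *-congʳ (sym (⟦cofactor⟧ x)) ⟩
          ⟦ s ⊕ shift e (lead ℤ.^ N ℤ.* a ∷ []) ⟧ x * ⟦ poly ⟧ x  ∎ }
      where
      open Multiple m₁ renaming (exponent to N; cofactor to s)
      open Solver
      e = length q₀ ℕ.∸ length init
      L = ι lead ^ N
      ⟦cofactor⟧ : ∀ x → ⟦ s ⊕ shift e (lead ℤ.^ N ℤ.* a ∷ []) ⟧ x ≈ ⟦ s ⟧ x + x ^ e * (L * ι a)
      ⟦cofactor⟧ x = trans (⟦⟧-⊕ s _ x) (+-congˡ (trans (⟦⟧-shift e (lead ℤ.^ N ℤ.* a ∷ []) x)
        (*-congˡ (trans (⟦⟧-const (lead ℤ.^ N ℤ.* a) x) (trans (ι-* (lead ℤ.^ N) a) (*-congʳ (ι-^ lead N)))))))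

    root⇒multiple : ∀ q → ⟦ q ⟧ ξ ≈ 0# → Multiple q
    root⇒multiple q = go (length q) q ℕP.≤-refl
      where
      go : ∀ L q → length q ≤ L → ⟦ q ⟧ ξ ≈ 0# → Multiple q
      go zero    q q≤0 qξ≈0 = short-root⇒multiple q (ℕP.≤-trans q≤0 z≤n) qξ≈0
      go (suc L) q q≤L qξ≈0 with initLast q
      ... | []       = short-root⇒multiple [] z≤n qξ≈0
      ... | q₀ ∷ʳ′ a with length init ℕP.≤? length q₀
      ...   | no  init≰q₀ = short-root⇒multiple (q₀ ∷ʳ a) (ℕP.≤-trans (ℕP.≤-reflexive (length-∷ʳ q₀ a)) (ℕP.≰⇒> init≰q₀)) qξ≈0
      ...   | yes init≤q₀ = lower-multiple⇒multiple q₀ a init≤q₀ (go L (lower q₀ a) q₁≤L (lower-root q₀ a init≤q₀ qξ≈0))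
        where
        q₁≤L : length (lower q₀ a) ≤ L
        q₁≤L = ℕP.≤-trans (length-lower q₀ a init≤q₀) (ℕP.≤-pred (ℕP.≤-trans (ℕP.≤-reflexive (≡.sym (length-∷ʳ q₀ a))) q≤L))

    root⇒root : ∀ q → ⟦ q ⟧ ξ ≈ 0# → ∀ {ζ} → ⟦ poly ⟧ ζ ≈ 0# → ⟦ q ⟧ ζ ≈ 0#
    root⇒root q qξ≈0 {ζ} polyζ≈0 = *-cancelˡ (ι[lead]^≉0 exponent)
      (trans (equation ζ) (trans (*-congˡ polyζ≈0) (trans (zeroʳ _) (sym (zeroʳ _)))))
      where open Multiple (root⇒multiple q qξ≈0)

module Cyclotomic {c ℓ} (R : CommutativeRing c ℓ) (dom : IsChar0Domain R) where

  open NumberTheory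
  open CommutativeRing R
  open SetoidReasoning setoid
  open IsChar0Domain dom
  open IntegerPolynomial
  open RingLemmas R
  open Evaluation R
  open IntegerPolynomialFunctions R
  open Frobenius R
  open Char0Domain R dom
  open MinimalPolynomials R dom
  open MinimalPolynomial using (init; lead; poly)

  module _ {m} .{{_ : NonZero m}} {ξ} (ξ-primitive : IsPrimitiveRoot R m ξ) where

    open PrimitiveRoot ξ-primitive

    minimal-roots-symmetric : (f : MinimalPolynomial ξ) → length (poly f) ≤ m →
      ∀ {ζ} → ⟦ poly f ⟧ ζ ≈ 0# → (g : MinimalPolynomial ζ) → ⟦ poly g ⟧ ξ ≈ 0#
    -- lead(g)ᴺ f = s g; if s ξ ≈ 0 then s = 0 by minimality of f, so f would vanish at all m-th roots of unity.
    minimal-roots-symmetric f f≤m {ζ} fζ≈0 g = cofactor-argument (root⇒multiple g (poly f) fζ≈0)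
      where
      cofactor-argument : Multiple g (poly f) → ⟦ poly g ⟧ ξ ≈ 0#
      cofactor-argument M = [ (λ sξ≈0 → contradiction (vanishing-on-roots⇒IsZero (poly f) f≤m (λ i _ → f≈0 sξ≈0 (ξ ^ i))) (¬IsZero-poly f)) , id ]′
        (noZeroDivisors (⟦ cofactor ⟧ ξ) (⟦ poly g ⟧ ξ) (trans (sym (equation ξ)) (trans (*-congˡ (MinimalPolynomial.root f)) (zeroʳ _))))
        where
        open Multiple M
        s≤init : length cofactor ≤ length (init f)
        s≤init = ℕP.≤-trans length-cofactor (ℕP.≤-trans (ℕP.∸-monoʳ-≤ (length (poly f)) (1≤length-init g))
                   (ℕP.≤-reflexive (≡.cong ℕ.pred (length-∷ʳ (init f) (lead f)))))
        f≈0 : ⟦ cofactor ⟧ ξ ≈ 0# → ∀ x → ⟦ poly f ⟧ x ≈ 0#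
        f≈0 sξ≈0 x = *-cancelˡ (ι[lead]^≉0 g exponent) (trans (equation x)
          (trans (*-congʳ (IsZero⇒⟦⟧≈0 (MinimalPolynomial.minimal f cofactor s≤init sξ≈0) x)) (trans (zeroˡ _) (sym (zeroʳ _)))))

    roots-ζ,ζᵖ⇒root-ξᵖ : (f : MinimalPolynomial ξ) → length (poly f) ≤ m →
      ∀ {ζ} p → ⟦ poly f ⟧ ζ ≈ 0# → ⟦ poly f ⟧ (ζ ^ p) ≈ 0# → ¬ ¬ (⟦ poly f ⟧ (ξ ^ p) ≈ 0#)
    roots-ζ,ζᵖ⇒root-ξᵖ f f≤m {ζ} p fζ≈0 fζᵖ≈0 fξᵖ≉0 = ¬¬-minimalPolynomial (poly f) (¬IsZero-poly f) fζ≈0 λ (g , _) →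
      fξᵖ≉0 (trans (sym (⟦⟧-∘X^ (poly f) p ξ))
        (root⇒root g (poly f ∘X^ p) (trans (⟦⟧-∘X^ (poly f) p ζ) fζᵖ≈0) (minimal-roots-symmetric f f≤m fζ≈0 g)))

    module _ {p} (p-prime : Prime p) (p⊥m : Coprime p m) where

      private
        instance
          p≢0 : NonZero p
          p≢0 = prime⇒nonZero p-prime

      VanishesAtζorζᵖ : Poly → Set ℓ
      VanishesAtζorζᵖ w = ∀ i → i < m → ⟦ w ⟧ (ξ ^ i) * ⟦ w ⟧ ((ξ ^ i) ^ p) ≈ 0#

      -- With ζ = ξ ^ (i b % m), where b inverts p² modulo m: w (ξ ^ i) = w (ζ ^ p²) ≡ w ζ · w (ζ ^ p) · … = 0 (mod p).
      divisible-by-p : ∀ w → length w ≤ m → VanishesAtζorζᵖ w →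
        ∃[ w′ ] length w′ ≤ m × (∀ l → l < m → coeff w l ≡ coeff (scale (+ p) w′) l)
      divisible-by-p w w≤m w-vanishes = w′ , length-reduce m (V ∘X^ b) , coeff-determined-by-roots w (scale (+ p) w′) w≤m pw′≤m values
        where
        V : Poly
        V = proj₁ (frobenius² p-prime w)
        b : ℕ
        b = proj₁ (inverse-mod (coprime-* p⊥m p⊥m))
        w′ : Poly
        w′ = reduce m (V ∘X^ b)
        pw′≤m : length (scale (+ p) w′) ≤ m
        pw′≤m = ℕP.≤-trans (ℕP.≤-reflexive (length-scale (+ p) w′)) (length-reduce m (V ∘X^ b))
        values : ∀ i → i < m → ⟦ w ⟧ (ξ ^ i) ≈ ⟦ scale (+ p) w′ ⟧ (ξ ^ i)
        values i i<m = begin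
          ⟦ w ⟧ (ξ ^ i)                                                    ≈⟨ ⟦⟧-cong w ξⁱ≈ζ^[p*p] ⟩
          ⟦ w ⟧ (ζ ^ (p ℕ.* p))                                            ≈⟨ proj₂ (frobenius² p-prime w) ζ ⟩
          ⟦ w ⟧ ζ * ⟦ w ⟧ (ζ ^ p) * ⟦ w ⟧ ζ ^ (p ℕ.* p ℕ.∸ suc p) + ιℕ p * ⟦ V ⟧ ζ
                                                                           ≈⟨ +-congʳ (trans (*-congʳ (w-vanishes e (m%n<n (i ℕ.* b) m))) (zeroˡ _)) ⟩
          0# + ιℕ p * ⟦ V ⟧ ζ                                              ≈⟨ +-identityˡ _ ⟩
          ιℕ p * ⟦ V ⟧ ζ                                                   ≈⟨ *-congˡ (sym (trans (⟦⟧-∘X^ V b (ξ ^ i)) (⟦⟧-cong V (trans (sym (^-* ξ i b)) (η^n≈η^[n%m] (i ℕ.* b)))))) ⟩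
          ιℕ p * ⟦ V ∘X^ b ⟧ (ξ ^ i)                                       ≈⟨ *-congˡ (sym (⟦⟧-reduce m ([η^a]^m≈1 i) (V ∘X^ b))) ⟩
          ιℕ p * ⟦ w′ ⟧ (ξ ^ i)                                            ≈⟨ sym (⟦⟧-scale (+ p) w′ (ξ ^ i)) ⟩
          ⟦ scale (+ p) w′ ⟧ (ξ ^ i)                                       ∎
          where
          e = (i ℕ.* b) ℕ.% m
          ζ = ξ ^ e
          ξⁱ≈ζ^[p*p] : ξ ^ i ≈ ζ ^ (p ℕ.* p)
          ξⁱ≈ζ^[p*p] = begin
            ξ ^ i                            ≈⟨ η^n≈η^[n%m] i ⟩
            ξ ^ (i % m)                      ≡⟨ ≡.cong (ξ ^_) (≡.sym (proj₂ (inverse-mod (coprime-* p⊥m p⊥m)) i)) ⟩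
            ξ ^ ((e ℕ.* (p ℕ.* p)) % m)      ≈⟨ sym (η^n≈η^[n%m] (e ℕ.* (p ℕ.* p))) ⟩
            ξ ^ (e ℕ.* (p ℕ.* p))            ≈⟨ ^-* ξ e (p ℕ.* p) ⟩
            ζ ^ (p ℕ.* p)                    ∎

      VanishesAtζorζᵖ-÷p : ∀ w w′ → (∀ x → ⟦ w ⟧ x ≈ ιℕ p * ⟦ w′ ⟧ x) → VanishesAtζorζᵖ w → VanishesAtζorζᵖ w′
      VanishesAtζorζᵖ-÷p w w′ w≈pw′ w-vanishes i i<m = *-cancelˡ (*-≉0 (ιℕ-≉0 p) (ιℕ-≉0 p)) (begin
        (ιℕ p * ιℕ p) * (⟦ w′ ⟧ ζ * ⟦ w′ ⟧ (ζ ^ p))       ≈⟨ solve 3 (λ q x y → (q :* q) :* (x :* y) := (q :* x) :* (q :* y)) refl _ _ _ ⟩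
        (ιℕ p * ⟦ w′ ⟧ ζ) * (ιℕ p * ⟦ w′ ⟧ (ζ ^ p))       ≈⟨ sym (*-cong (w≈pw′ ζ) (w≈pw′ (ζ ^ p))) ⟩
        ⟦ w ⟧ ζ * ⟦ w ⟧ (ζ ^ p)                          ≈⟨ w-vanishes i i<m ⟩
        0#                                               ≈⟨ sym (zeroʳ _) ⟩
        (ιℕ p * ιℕ p) * 0#                               ∎)
        where
        open Solver
        ζ = ξ ^ i

      VanishesAtζorζᵖ⇒IsZero : ∀ w → length w ≤ m → VanishesAtζorζᵖ w → IsZero w
      VanishesAtζorζᵖ⇒IsZero w w≤m w-vanishes = decidable-stable (isZero? w) λ w≢0 →
        let j , j<w , wⱼ≢0 = ¬IsZero⇒nonzero-coeff w w≢0
        in descend (ℕP.<-≤-trans j<w w≤m) ℤ.∣ coeff w j ∣ w ℕP.≤-refl wⱼ≢0 w≤m w-vanishes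
        where
        descend : ∀ {j} → j < m → ∀ n w → ℤ.∣ coeff w j ∣ ≤ n → coeff w j ≢ 0ℤ → length w ≤ m → VanishesAtζorζᵖ w → ⊥
        descend j<m zero    w ∣wⱼ∣≤0 wⱼ≢0 _ _ = wⱼ≢0 (ℤP.∣i∣≡0⇒i≡0 (ℕP.n≤0⇒n≡0 ∣wⱼ∣≤0))
        descend {j} j<m (suc n) w ∣wⱼ∣≤1+n wⱼ≢0 w≤m w-vanishes = step (divisible-by-p w w≤m w-vanishes)
          where
          step : ∃[ w′ ] length w′ ≤ m × (∀ l → l < m → coeff w l ≡ coeff (scale (+ p) w′) l) → ⊥
          step (w′ , w′≤m , w≡pw′) = descend j<m n w′ ∣w′ⱼ∣≤n w′ⱼ≢0 w′≤m (VanishesAtζorζᵖ-÷p w w′ w≈pw′ w-vanishes)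
            where
            wⱼ≡pw′ⱼ : coeff w j ≡ + p ℤ.* coeff w′ j
            wⱼ≡pw′ⱼ = ≡.trans (w≡pw′ j j<m) (coeff-scale (+ p) w′ j)
            w′ⱼ≢0 : coeff w′ j ≢ 0ℤ
            w′ⱼ≢0 w′ⱼ≡0 = wⱼ≢0 (≡.trans wⱼ≡pw′ⱼ (≡.trans (≡.cong (+ p ℤ.*_) w′ⱼ≡0) (ℤP.*-zeroʳ (+ p))))
            ∣w′ⱼ∣≤n : ℤ.∣ coeff w′ j ∣ ≤ n
            ∣w′ⱼ∣≤n = ∣p*c∣≤1+n⇒∣c∣≤n (coeff w′ j) (ℕ.nonTrivial⇒n>1 p {{prime⇒nonTrivial p-prime}}) w′ⱼ≢0
                        (≡.subst (λ c → ℤ.∣ c ∣ ≤ suc n) wⱼ≡pw′ⱼ ∣wⱼ∣≤1+n)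
            w≈pw′ : ∀ x → ⟦ w ⟧ x ≈ ιℕ p * ⟦ w′ ⟧ x
            w≈pw′ x = trans (⟦⟧-coeff-cong w (scale (+ p) w′) w≤m (ℕP.≤-trans (ℕP.≤-reflexive (length-scale (+ p) w′)) w′≤m) w≡pw′ x)
                            (⟦⟧-scale (+ p) w′ x)

      -- The cofactor s of Xᵐ - 1 = s · f (up to a constant) vanishes wherever f does not, so
      -- VanishesAtζorζᵖ s would follow if f (ξ ^ p) ≉ 0; but s ≠ 0.
      ¬¬-minimal-root-of-power : (f : MinimalPolynomial ξ) → length (poly f) ≤ m → ¬ ¬ (⟦ poly f ⟧ (ξ ^ p) ≈ 0#)
      ¬¬-minimal-root-of-power f f≤m = cofactor-argument (root⇒multiple f (Xⁿ-1 m) ξᵐ-1≈0)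
        where
        ξᵐ-1≈0 : ⟦ Xⁿ-1 m ⟧ ξ ≈ 0#
        ξᵐ-1≈0 = trans (⟦⟧-Xⁿ-1 m ξ) (x≈y⇒x-y≈0 (IsPrimitiveRoot.root ξ-primitive))
        cofactor-argument : Multiple f (Xⁿ-1 m) → ¬ ¬ (⟦ poly f ⟧ (ξ ^ p) ≈ 0#)
        cofactor-argument M fξᵖ≉0 = ¬¬-∀< m (λ i _ → ¬¬-vanishes i) λ s-vanishes →
          ¬IsZero-s (VanishesAtζorζᵖ⇒IsZero s s≤m s-vanishes)
          where
          open Multiple M renaming (cofactor to s)
          s≤m : length s ≤ m
          s≤m = ℕP.≤-trans length-cofactor (ℕP.∸-mono (length-Xⁿ-1 m) (1≤length-init f))
          ¬IsZero-s : ¬ IsZero s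
          ¬IsZero-s s≡0 = nontrivial (trans (sym (x-y≈0⇒x≈y (begin
            0# ^ m - 1#                  ≈⟨ sym (⟦⟧-Xⁿ-1 m 0#) ⟩
            ⟦ Xⁿ-1 m ⟧ 0#                ≈⟨ *-cancelˡ (ι[lead]^≉0 f exponent) (trans (equation 0#)
                                              (trans (*-congʳ (IsZero⇒⟦⟧≈0 s≡0 0#)) (trans (zeroˡ _) (sym (zeroʳ _))))) ⟩
            0#                           ∎))) (0^n≈0 m))
          s-vanishes-off-f : ∀ {ζ} → ζ ^ m ≈ 1# → ⟦ poly f ⟧ ζ ≉ 0# → ⟦ s ⟧ ζ ≈ 0#
          s-vanishes-off-f {ζ} ζᵐ≈1 fζ≉0 = [ id , (λ fζ≈0 → contradiction fζ≈0 fζ≉0) ]′ (noZeroDivisors (⟦ s ⟧ ζ) (⟦ poly f ⟧ ζ)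
            (trans (sym (equation ζ)) (trans (*-congˡ (trans (⟦⟧-Xⁿ-1 m ζ) (x≈y⇒x-y≈0 ζᵐ≈1))) (zeroʳ _))))
          ¬¬-vanishes : ∀ i → ¬ ¬ (⟦ s ⟧ (ξ ^ i) * ⟦ s ⟧ ((ξ ^ i) ^ p) ≈ 0#)
          ¬¬-vanishes i ¬vanishes = ¬¬-excluded-middle {A = ⟦ poly f ⟧ ζ ≈ 0#} λ
            { (no fζ≉0)  → ¬vanishes (trans (*-congʳ (s-vanishes-off-f ([η^a]^m≈1 i) fζ≉0)) (zeroˡ _))
            ; (yes fζ≈0) → ¬¬-excluded-middle {A = ⟦ poly f ⟧ (ζ ^ p) ≈ 0#} λ
              { (no fζᵖ≉0)  → ¬vanishes (trans (*-congˡ (s-vanishes-off-f ζᵖᵐ≈1 fζᵖ≉0)) (zeroʳ _))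
              ; (yes fζᵖ≈0) → roots-ζ,ζᵖ⇒root-ξᵖ f f≤m p fζ≈0 fζᵖ≈0 fξᵖ≉0 } }
            where
            ζ = ξ ^ i
            ζᵖᵐ≈1 : (ζ ^ p) ^ m ≈ 1#
            ζᵖᵐ≈1 = trans (^-comm ζ p m) (trans (^-congˡ p ([η^a]^m≈1 i)) (1^n p))

      ¬¬-root-at-prime-power : ∀ u → ⟦ u ⟧ ξ ≈ 0# → ¬ ¬ (⟦ u ⟧ (ξ ^ p) ≈ 0#)
      ¬¬-root-at-prime-power u uξ≈0 uξᵖ≉0 = ¬¬-minimalPolynomial u′ u′≢0 u′ξ≈0 λ (f , f<u′) →
        ¬¬-minimal-root-of-power f (f≤m f f<u′) λ fξᵖ≈0 → uξᵖ≉0 (trans (sym u′ξᵖ≈uξᵖ) (root⇒root f u′ u′ξ≈0 fξᵖ≈0))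
        where
        u′ = reduce m u
        u′ξ≈0 : ⟦ u′ ⟧ ξ ≈ 0#
        u′ξ≈0 = trans (⟦⟧-reduce m (IsPrimitiveRoot.root ξ-primitive) u) uξ≈0
        u′ξᵖ≈uξᵖ : ⟦ u′ ⟧ (ξ ^ p) ≈ ⟦ u ⟧ (ξ ^ p)
        u′ξᵖ≈uξᵖ = ⟦⟧-reduce m ([η^a]^m≈1 p) u
        u′≢0 : ¬ IsZero u′
        u′≢0 u′≡0 = uξᵖ≉0 (trans (sym u′ξᵖ≈uξᵖ) (IsZero⇒⟦⟧≈0 u′≡0 _))
        f≤m : ∀ f → length (init f) < length u′ → length (poly f) ≤ m
        f≤m f f<u′ = ℕP.≤-trans (ℕP.≤-reflexive (length-∷ʳ (init f) (lead f))) (ℕP.≤-trans f<u′ (length-reduce m u))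

  ¬¬-root-at-coprime-power : ∀ {m} .{{_ : NonZero m}} {ξ} → IsPrimitiveRoot R m ξ → ∀ {a} .{{_ : NonZero a}} → Coprime a m →
    ∀ u → ⟦ u ⟧ ξ ≈ 0# → ¬ ¬ (⟦ u ⟧ (ξ ^ a) ≈ 0#)
  ¬¬-root-at-coprime-power {m} {ξ} ξ-primitive {a} a⊥m u uξ≈0 = ≡.subst (λ a → ¬ ¬ (⟦ u ⟧ (ξ ^ a) ≈ 0#)) (≡.sym isFactorisation)
    (along factors factorsPrime (≡.subst (λ a → Coprime a m) isFactorisation a⊥m) ξ-primitive uξ≈0)
    where
    open PrimeFactorisation (factorise a)
    along : ∀ ps → All Prime ps → Coprime (product ps) m →
            ∀ {ζ} → IsPrimitiveRoot R m ζ → ⟦ u ⟧ ζ ≈ 0# → ¬ ¬ (⟦ u ⟧ (ζ ^ product ps) ≈ 0#)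
    along []       []                   _      _            uζ≈0 ¬done = ¬done (trans (⟦⟧-cong u (*-identityʳ _)) uζ≈0)
    along (p ∷ ps) (p-prime ∷ ps-prime) Πps⊥m ζ-primitive uζ≈0 ¬done =
      ¬¬-root-at-prime-power ζ-primitive p-prime p⊥m u uζ≈0 λ uζᵖ≈0 →
        along ps ps-prime ps⊥m (PrimitiveRoot.coprime⇒primitive ζ-primitive p⊥m) uζᵖ≈0 λ done →
          ¬done (trans (⟦⟧-cong u (^-* _ p (product ps))) done)
      where
      p⊥m : Coprime p m
      p⊥m = coprime-∣ (m∣m*n (product ps)) Πps⊥m
      ps⊥m : Coprime (product ps) m
      ps⊥m = coprime-∣ (n∣m*n p) Πps⊥m

  ⟦∏Xᵈ-1⟧≈0 : ∀ {ζ} n {e} → 0 < e → e ≤ n → ζ ^ e ≈ 1# → ⟦ ∏Xᵈ-1 n ⟧ ζ ≈ 0#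
  ⟦∏Xᵈ-1⟧≈0       zero    {suc e} _   ()
  ⟦∏Xᵈ-1⟧≈0 {ζ} (suc n) {e} 0<e e≤1+n ζᵉ≈1 = trans (⟦⟧-⊗ (∏Xᵈ-1 n) (Xⁿ-1 (suc n)) ζ) (factor (ℕP.m≤n⇒m<n∨m≡n e≤1+n))
    where
    factor : e < suc n ⊎ e ≡ suc n → ⟦ ∏Xᵈ-1 n ⟧ ζ * ⟦ Xⁿ-1 (suc n) ⟧ ζ ≈ 0#
    factor (inj₁ e<1+n) = trans (*-congʳ (⟦∏Xᵈ-1⟧≈0 n 0<e (ℕP.≤-pred e<1+n) ζᵉ≈1)) (zeroˡ _)
    factor (inj₂ ≡.refl) = trans (*-congˡ (trans (⟦⟧-Xⁿ-1 e ζ) (x≈y⇒x-y≈0 ζᵉ≈1))) (zeroʳ _)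

  ⟦∏Xᵈ-1⟧≉0 : ∀ {ζ} n → (∀ e → 0 < e → e ≤ n → ζ ^ e ≉ 1#) → ⟦ ∏Xᵈ-1 n ⟧ ζ ≉ 0#
  ⟦∏Xᵈ-1⟧≉0 {ζ} zero    _      = λ 1≈0 → nontrivial (trans (sym (⟦⟧-1ₚ ζ)) 1≈0)
  ⟦∏Xᵈ-1⟧≉0 {ζ} (suc n) ζᵉ≉1 = λ H≈0 → *-≉0 (⟦∏Xᵈ-1⟧≉0 n (λ e 0<e e≤n → ζᵉ≉1 e 0<e (ℕP.m≤n⇒m≤1+n e≤n)))
    (λ ζⁿ-1≈0 → ζᵉ≉1 (suc n) (s≤s z≤n) ℕP.≤-refl (x-y≈0⇒x≈y (trans (sym (⟦⟧-Xⁿ-1 (suc n) ζ)) ζⁿ-1≈0)))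
    (trans (sym (⟦⟧-⊗ (∏Xᵈ-1 n) (Xⁿ-1 (suc n)) ζ)) H≈0)

  -- Φₘ ∣ u, stated without Φₘ: Xᵐ - 1 divides u · ∏_{d<m} (Xᵈ - 1), whose factors cover all Φ_d with d ∣ m, d < m.
  -- Unlike vanishing at the primitive roots, this is decidable.
  CyclotomicMultiple : ℕ → Poly → Set
  CyclotomicMultiple m u = IsZero (reduce m (u ⊗ ∏Xᵈ-1 (ℕ.pred m)))

  cyclotomicMultiple? : ∀ m u → Dec (CyclotomicMultiple m u)
  cyclotomicMultiple? m u = isZero? (reduce m (u ⊗ ∏Xᵈ-1 (ℕ.pred m)))

  module _ {m} .{{_ : NonZero m}} {ξ} (ξ-primitive : IsPrimitiveRoot R m ξ) where

    open PrimitiveRoot ξ-primitive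

    private
      H : Poly
      H = ∏Xᵈ-1 (ℕ.pred m)

    -- u · H vanishes at every m-th root of unity: at the primitive ones by conjugacy, at the others through H.
    root⇒cyclotomicMultiple : ∀ u → ⟦ u ⟧ ξ ≈ 0# → CyclotomicMultiple m u
    root⇒cyclotomicMultiple u uξ≈0 = decidable-stable (isZero? _) λ ¬multiple →
      ¬¬-∀< m (λ i _ → ¬¬-uH-vanishes i) λ uH-vanishes →
        ¬multiple (vanishing-on-roots⇒IsZero _ (length-reduce m (u ⊗ H)) (λ i i<m → trans (⟦⟧-reduce m ([η^a]^m≈1 i) (u ⊗ H)) (uH-vanishes i i<m)))
      where
      ¬¬-uH-vanishes : ∀ i → ¬ ¬ (⟦ u ⊗ H ⟧ (ξ ^ i) ≈ 0#)
      ¬¬-uH-vanishes i with coprime? i m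
      ... | yes i⊥m = λ ¬vanishes → ¬¬-root-at-coprime-power ξ-primitive {m ℕ.+ i} {{m+i≢0}} (coprime-+ i⊥m) u uξ≈0 λ uξᵐ⁺ⁱ≈0 →
        ¬vanishes (trans (⟦⟧-⊗ u H _) (trans (*-congʳ (trans (⟦⟧-cong u (sym ξᵐ⁺ⁱ≈ξⁱ)) uξᵐ⁺ⁱ≈0)) (zeroˡ _)))
        where
        m+i≢0 : NonZero (m ℕ.+ i)
        m+i≢0 = ℕ.>-nonZero (ℕP.<-≤-trans (ℕ.>-nonZero⁻¹ m) (ℕP.m≤m+n m i))
        ξᵐ⁺ⁱ≈ξⁱ : ξ ^ (m ℕ.+ i) ≈ ξ ^ i
        ξᵐ⁺ⁱ≈ξⁱ = trans (^-+ ξ m i) (trans (*-congʳ (IsPrimitiveRoot.root ξ-primitive)) (*-identityˡ _))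
      ... | no ¬i⊥m = λ ¬vanishes → ¬vanishes (trans (⟦⟧-⊗ u H _) (trans (*-congˡ Hξⁱ≈0) (zeroʳ _)))
        where
        Hξⁱ≈0 : ⟦ H ⟧ (ξ ^ i) ≈ 0#
        Hξⁱ≈0 with non-coprime⇒proper-period ¬i⊥m
        ... | e , 0<e , e<m , divides q ie≡qm =
          ⟦∏Xᵈ-1⟧≈0 (ℕ.pred m) 0<e (ℕP.<⇒≤pred e<m) (trans (sym (^-* ξ i e)) (trans (reflexive (≡.cong (ξ ^_) ie≡qm)) (η^[q*m]≈1 q)))

    cyclotomicMultiple⇒root : ∀ u → CyclotomicMultiple m u → ∀ {a} → Coprime a m → ⟦ u ⟧ (ξ ^ a) ≈ 0#
    cyclotomicMultiple⇒root u multiple {a} a⊥m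
      with noZeroDivisors (⟦ u ⟧ (ξ ^ a)) (⟦ H ⟧ (ξ ^ a))
             (trans (sym (⟦⟧-⊗ u H _)) (trans (sym (⟦⟧-reduce m ([η^a]^m≈1 a) (u ⊗ H))) (IsZero⇒⟦⟧≈0 multiple _)))
    ... | inj₁ uξᵃ≈0 = uξᵃ≈0
    ... | inj₂ Hξᵃ≈0 = contradiction Hξᵃ≈0 (⟦∏Xᵈ-1⟧≉0 (ℕ.pred m) λ e 0<e e≤pred[m] →
            IsPrimitiveRoot.minimal (coprime⇒primitive a⊥m) e 0<e
              (ℕP.≤-trans (s≤s e≤pred[m]) (ℕP.≤-reflexive (ℕP.suc-pred m))))

module Autocorrelation {c ℓ} (R : CommutativeRing c ℓ) where

  open CommutativeRing R
  open SetoidReasoning setoid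
  open IntegerPolynomial
  open RingLemmas R
  open Evaluation R

  ∑-periodic-shift : ∀ n (f : ℕ → Carrier) → (∀ i → f (n ℕ.+ i) ≈ f i) → ∀ s → ∑[ i < n ] f (i ℕ.+ s) ≈ ∑ n f
  ∑-periodic-shift n f f-periodic zero    = ∑-cong′ n (λ i → reflexive (≡.cong f (ℕP.+-identityʳ i)))
  ∑-periodic-shift n f f-periodic (suc s) = begin
    ∑[ i < n ] f (i ℕ.+ suc s)    ≈⟨ ∑-cong′ n (λ i → reflexive (≡.cong f (ℕP.+-suc i s))) ⟩
    ∑[ i < n ] f (suc i ℕ.+ s)    ≈⟨ ∑-rotate n (λ i → f (i ℕ.+ s)) (f-periodic s) ⟩
    ∑[ i < n ] f (i ℕ.+ s)        ≈⟨ ∑-periodic-shift n f f-periodic s ⟩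
    ∑ n f                         ∎

  module _ (k : ℕ) .{{_ : NonZero k}} where

    seqPoly : (Fin k → ℤ) → Poly
    seqPoly x = applyUpTo (at k x) k

    at-periodic : ∀ x i → at k x (k ℕ.+ i) ≡ at k x i
    at-periodic x i = ≡.cong x (fromℕ<-cong _ _ (≡.trans (≡.cong (_% k) (ℕP.+-comm k i)) ([m+n]%n≡m%n i k)) _ _)

    fourier≈⟦seqPoly⟧ : ∀ ω x j → fourier R k ω x j ≈ ⟦ seqPoly x ⟧ (ω ^ j)
    fourier≈⟦seqPoly⟧ ω x j = trans (∑-cong′ k (λ l → *-congˡ (^-* ω j l))) (sym (⟦⟧-applyUpTo (at k x) k (ω ^ j)))

    private
      term : (Fin k → ℤ) → Carrier → ℕ → Carrier
      term x ζ l = ι (at k x l) * ζ ^ l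

      term-periodic : ∀ x {ζ} → ζ ^ k ≈ 1# → ∀ l → term x ζ (k ℕ.+ l) ≈ term x ζ l
      term-periodic x {ζ} ζᵏ≈1 l = *-cong (reflexive (≡.cong ι (at-periodic x l))) (trans (^-+ ζ k l) (trans (*-congʳ ζᵏ≈1) (*-identityˡ _)))

    ⟦seqPoly⟧-product : ∀ x {ζ ζ′} → ζ ^ k ≈ 1# → ζ * ζ′ ≈ 1# →
      ⟦ seqPoly x ⟧ ζ * ⟦ seqPoly x ⟧ ζ′ ≈ ∑[ d < k ] ζ ^ suc d * ι (S₂ k x (suc d) k)
    ⟦seqPoly⟧-product x {ζ} {ζ′} ζᵏ≈1 ζζ′≈1 = begin
      ⟦ seqPoly x ⟧ ζ * ⟦ seqPoly x ⟧ ζ′                                    ≈⟨ *-cong (⟦⟧-applyUpTo (at k x) k ζ) (⟦⟧-applyUpTo (at k x) k ζ′) ⟩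
      ∑ k (term x ζ) * ∑ k (term x ζ′)                                      ≈⟨ *-congˡ (sym (∑-rotate k (term x ζ′) (trans (reflexive (≡.cong (term x ζ′) (≡.sym (ℕP.+-identityʳ k)))) (term-periodic x ζ′ᵏ≈1 0)))) ⟩
      ∑ k (term x ζ) * (∑[ j < k ] term x ζ′ (suc j))                       ≈⟨ ∑-*ˡ k _ _ ⟩
      ∑[ j < k ] ∑ k (term x ζ) * term x ζ′ (suc j)                         ≈⟨ ∑-cong′ k (λ j → *-congʳ (sym (∑-periodic-shift k (term x ζ) (term-periodic x ζᵏ≈1) (suc (suc j))))) ⟩
      ∑[ j < k ] (∑[ d < k ] term x ζ (d ℕ.+ suc (suc j))) * term x ζ′ (suc j) ≈⟨ ∑-cong′ k (λ j → ∑-*ʳ k _ _) ⟩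
      ∑[ j < k ] ∑[ d < k ] term x ζ (d ℕ.+ suc (suc j)) * term x ζ′ (suc j)   ≈⟨ ∑-swap k k _ ⟩
      ∑[ d < k ] ∑[ j < k ] term x ζ (d ℕ.+ suc (suc j)) * term x ζ′ (suc j)   ≈⟨ ∑-cong′ k (λ d → trans (∑-cong′ k (regroup d)) (sym (∑-*ˡ k _ _))) ⟩
      ∑[ d < k ] ζ ^ suc d * (∑[ j < k ] ι (at k x (suc d ℕ.+ suc j) ℤ.* at k x (k ℕ.+ suc j)))
                                                                            ≈⟨ ∑-cong′ k (λ d → *-congˡ (sym (ι-sumℤ k _))) ⟩
      ∑[ d < k ] ζ ^ suc d * ι (S₂ k x (suc d) k)                           ∎
      where
      ζ′ᵏ≈1 : ζ′ ^ k ≈ 1#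
      ζ′ᵏ≈1 = trans (sym (*-identityˡ _)) (trans (*-congʳ (sym ζᵏ≈1)) (trans (sym (^-distrib-* ζ ζ′ k)) (trans (^-congˡ k ζζ′≈1) (1^n k))))
      regroup : ∀ d j → term x ζ (d ℕ.+ suc (suc j)) * term x ζ′ (suc j) ≈ ζ ^ suc d * ι (at k x (suc d ℕ.+ suc j) ℤ.* at k x (k ℕ.+ suc j))
      regroup d j = begin
        ι (at k x (d ℕ.+ suc (suc j))) * ζ ^ (d ℕ.+ suc (suc j)) * (ι (at k x (suc j)) * ζ′ ^ suc j)
          ≈⟨ *-cong (*-cong (reflexive (≡.cong (λ n → ι (at k x n)) reassoc)) (trans (reflexive (≡.cong (ζ ^_) reassoc)) (^-+ ζ (suc d) (suc j))))
                    (*-congʳ (reflexive (≡.cong ι (≡.sym (at-periodic x (suc j)))))) ⟩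
        ι A * (ζ ^ suc d * ζ ^ suc j) * (ι B * ζ′ ^ suc j)
          ≈⟨ solve 5 (λ a z w b v → a :* (z :* w) :* (b :* v) := z :* (a :* b) :* (w :* v)) refl _ _ _ _ _ ⟩
        ζ ^ suc d * (ι A * ι B) * (ζ ^ suc j * ζ′ ^ suc j)
          ≈⟨ *-cong (*-congˡ (sym (ι-* A B))) (trans (sym (^-distrib-* ζ ζ′ (suc j))) (trans (^-congˡ (suc j) ζζ′≈1) (1^n (suc j)))) ⟩
        ζ ^ suc d * ι (A ℤ.* B) * 1#
          ≈⟨ *-identityʳ _ ⟩
        ζ ^ suc d * ι (A ℤ.* B)
          ∎
        where
        open Solver
        reassoc : d ℕ.+ suc (suc j) ≡ suc d ℕ.+ suc j
        reassoc = ℕP.+-suc d (suc j)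
        A = at k x (suc d ℕ.+ suc j)
        B = at k x (k ℕ.+ suc j)

    S₂-determines-|x̂|² : ∀ x y → (∀ i₁ i₂ → 1 ≤ i₁ → i₁ ≤ k → 1 ≤ i₂ → i₂ ≤ k → S₂ k x i₁ i₂ ≡ S₂ k y i₁ i₂) →
      ∀ {ζ ζ′} → ζ ^ k ≈ 1# → ζ * ζ′ ≈ 1# → ⟦ seqPoly x ⟧ ζ * ⟦ seqPoly x ⟧ ζ′ ≈ ⟦ seqPoly y ⟧ ζ * ⟦ seqPoly y ⟧ ζ′
    S₂-determines-|x̂|² x y S₂≡ ζᵏ≈1 ζζ′≈1 = trans (⟦seqPoly⟧-product x ζᵏ≈1 ζζ′≈1)
      (trans (∑-cong k (λ d d<k → *-congˡ (reflexive (≡.cong ι (S₂≡ (suc d) k (s≤s z≤n) d<k (ℕ.>-nonZero⁻¹ k) ℕP.≤-refl)))))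
             (sym (⟦seqPoly⟧-product y ζᵏ≈1 ζζ′≈1)))

module FourierDichotomy {c ℓ} (R : CommutativeRing c ℓ) (dom : IsChar0Domain R)
  {k} .{{_ : NonZero k}} {ω} (ω-primitive : IsPrimitiveRoot R k ω) (x y : Fin k → ℤ)
  (S₂≡ : ∀ i₁ i₂ → 1 ≤ i₁ → i₁ ≤ k → 1 ≤ i₂ → i₂ ≤ k → S₂ k x i₁ i₂ ≡ S₂ k y i₁ i₂)
  {m α} .{{_ : NonZero α}} (k≡mα : k ≡ m ℕ.* α) where

  open CommutativeRing R
  open IsChar0Domain dom
  open NumberTheory
  open IntegerPolynomial
  open RingLemmas R
  open Evaluation R
  open Char0Domain R dom
  open Cyclotomic R dom
  open Autocorrelation R

  private
    instance
      m≢0 : NonZero m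
      m≢0 = ℕ.≢-nonZero (λ m≡0 → ℕ.≢-nonZero⁻¹ k (≡.trans k≡mα (≡.cong (ℕ._* α) m≡0)))

  η : Carrier
  η = ω ^ α

  η-primitive : IsPrimitiveRoot R m η
  η-primitive = PrimitiveRoot.^-divisor-primitive ω-primitive k≡mα

  open PrimitiveRoot η-primitive

  fourier[a*α] : ∀ z a → fourier R k ω z (a ℕ.* α) ≈ ⟦ seqPoly k z ⟧ (η ^ a)
  fourier[a*α] z a = trans (fourier≈⟦seqPoly⟧ k ω z (a ℕ.* α))
    (⟦⟧-cong (seqPoly k z) (trans (reflexive (≡.cong (ω ^_) (ℕP.*-comm a α))) (^-* ω α a)))

  Φ∣ : (Fin k → ℤ) → Set
  Φ∣ z = CyclotomicMultiple m (seqPoly k z)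

  vanishes : ∀ z → Φ∣ z → ∀ {j} → InG k α j → fourier R k ω z j ≈ 0#
  vanishes z Φ∣z {j} (_ , j≤k , gcd≡α) with gcd≡α⇒coprime-quotient m k≡mα j≤k gcd≡α
  ... | a , ≡.refl , a⊥m = trans (fourier[a*α] z a) (cyclotomicMultiple⇒root η-primitive (seqPoly k z) Φ∣z a⊥m)

  nonvanishing : ∀ z → ¬ Φ∣ z → ∀ {j} → InG k α j → fourier R k ω z j ≉ 0#
  nonvanishing z ¬Φ∣z {j} (_ , j≤k , gcd≡α) ẑⱼ≈0 with gcd≡α⇒coprime-quotient m k≡mα j≤k gcd≡α
  ... | a , ≡.refl , a⊥m = ¬Φ∣z (root⇒cyclotomicMultiple (coprime⇒primitive a⊥m) (seqPoly k z) (trans (sym (fourier[a*α] z a)) ẑⱼ≈0))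

  private
    1≤m : 1 ≤ m
    1≤m = ℕ.>-nonZero⁻¹ m

    ζ ζ′ : Carrier
    ζ  = η ^ 1
    ζ′ = η ^ (m ℕ.∸ 1)

    ζ⊥m : Coprime 1 m
    ζ⊥m = 1-coprimeTo m

    ζ′⊥m : Coprime (m ℕ.∸ 1) m
    ζ′⊥m = coprime-∸ 1≤m (1-coprimeTo m)

    |x̂|²≈|ŷ|² : ⟦ seqPoly k x ⟧ ζ * ⟦ seqPoly k x ⟧ ζ′ ≈ ⟦ seqPoly k y ⟧ ζ * ⟦ seqPoly k y ⟧ ζ′
    |x̂|²≈|ŷ|² = S₂-determines-|x̂|² k x y S₂≡ ζᵏ≈1 ζζ′≈1
      where
      ζᵏ≈1 : ζ ^ k ≈ 1#
      ζᵏ≈1 = trans (reflexive (≡.cong (ζ ^_) k≡mα)) (trans (^-* ζ m α) (trans (^-congˡ α ([η^a]^m≈1 1)) (1^n α)))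
      ζζ′≈1 : ζ * ζ′ ≈ 1#
      ζζ′≈1 = trans (sym (^-+ η 1 (m ℕ.∸ 1))) (trans (reflexive (≡.cong (η ^_) (ℕP.m+[n∸m]≡n 1≤m))) (IsPrimitiveRoot.root η-primitive))

    Φ∣-transfer : ∀ {z z′} → ⟦ seqPoly k z ⟧ ζ * ⟦ seqPoly k z ⟧ ζ′ ≈ ⟦ seqPoly k z′ ⟧ ζ * ⟦ seqPoly k z′ ⟧ ζ′ → Φ∣ z → Φ∣ z′
    Φ∣-transfer {z} {z′} same Φ∣z with noZeroDivisors (⟦ seqPoly k z′ ⟧ ζ) (⟦ seqPoly k z′ ⟧ ζ′)
      (trans (sym same) (trans (*-congʳ (cyclotomicMultiple⇒root η-primitive (seqPoly k z) Φ∣z ζ⊥m)) (zeroˡ _)))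
    ... | inj₁ z′ζ≈0  = root⇒cyclotomicMultiple (coprime⇒primitive ζ⊥m) (seqPoly k z′) z′ζ≈0
    ... | inj₂ z′ζ′≈0 = root⇒cyclotomicMultiple (coprime⇒primitive ζ′⊥m) (seqPoly k z′) z′ζ′≈0

  dichotomy : (∀ j → InG k α j → fourier R k ω x j ≉ 0# × fourier R k ω y j ≉ 0#)
            ⊎ (∀ j → InG k α j → fourier R k ω x j ≈ 0# × fourier R k ω y j ≈ 0#)
  dichotomy with cyclotomicMultiple? m (seqPoly k x)
  ... | yes Φ∣x = inj₂ λ j j∈G → vanishes x Φ∣x j∈G , vanishes y (Φ∣-transfer {x} {y} |x̂|²≈|ŷ|² Φ∣x) j∈G
  ... | no ¬Φ∣x = inj₁ λ j j∈G → nonvanishing x ¬Φ∣x j∈G , nonvanishing y (λ Φ∣y → ¬Φ∣x (Φ∣-transfer {y} {x} (sym |x̂|²≈|ŷ|²) Φ∣y)) j∈G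

lemma3p5 : ∀ {c ℓ : Level} (R : CommutativeRing c ℓ) → IsChar0Domain R →
    (k : ℕ) .{{_ : NonZero k}} → (ω : CommutativeRing.Carrier R) → IsPrimitiveRoot R k ω →
    (x y : Fin k → ℤ) →
    (∀ i₁ i₂ → 1 ≤ i₁ → i₁ ≤ k → 1 ≤ i₂ → i₂ ≤ k → S₂ k x i₁ i₂ ≡ S₂ k y i₁ i₂) →
    ∀ α → 1 ≤ α → α ≤ k →
    (∀ j → InG k α j →
      ¬ (CommutativeRing._≈_ R (fourier R k ω x j) (CommutativeRing.0# R))
      × ¬ (CommutativeRing._≈_ R (fourier R k ω y j) (CommutativeRing.0# R)))
    ⊎ (∀ j → InG k α j →
      CommutativeRing._≈_ R (fourier R k ω x j) (CommutativeRing.0# R)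
      × CommutativeRing._≈_ R (fourier R k ω y j) (CommutativeRing.0# R))
lemma3p5 R dom k ω ω-primitive x y S₂≡ α 1≤α α≤k with α ∣? k
... | no  α∤k               = inj₂ λ j (_ , _ , gcd≡α) → contradiction (≡.subst (_∣ k) gcd≡α (gcd[m,n]∣n j k)) α∤k
... | yes (divides m k≡mα) = FourierDichotomy.dichotomy R dom ω-primitive x y S₂≡ {m} {α} {{ℕ.>-nonZero 1≤α}} k≡mα
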